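{- Let $G=(V,E)$ be an unweighted undirected graph with $n=|V|$, $m=|E|$, whose edges arrive as a stream $e_1,\ldots,e_m$ in a uniformly random order. Let $0<\epsilon<1/2$, and assume $\mu(G)\ge 20\log(n)\epsilon^{ -2}$. Let $G^{late}=(V,E^{late})$ where $E^{late}=\{e_{\epsilon m+1},\ldots,e_m\}$ (all edges except the first $\epsilon m$ of the stream). Then $\Pr[\mu(G^{late})\ge(1-2\epsilon)\mu(G)]\ge 1-n^{ -5}$.
   Context: $\mu(H)$ denotes the size of a maximum matching in a graph $H$. The probability is over the uniformly random permutation of the edges forming the stream.
   Formalization: The parameter ε ranges over the rationals, and log is the natural logarithm. -}

module Defs where

open import Data.Nat as ℕ using (ℕ; zero; suc; _⊔_)
open import Data.Integer as ℤ using (+_; ∣_∣)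
open import Data.Rational as ℚ using (ℚ; _/_; 0ℚ; 1ℚ)
open import Data.Fin using (Fin; _<_; _≟_)
open import Data.Product using (_×_; _,_; ∃)
open import Data.Bool using (Bool; true; false; _∧_; not)
open import Data.List using (List; []; _∷_; map; _++_; length; concatMap; foldr; drop; [_])
open import Data.List.Relation.Unary.All using (All)
open import Data.List.Relation.Unary.Unique.Propositional using (Unique)
open import Relation.Nullary.Decidable using (⌊_⌋)

-- An undirected edge {u,v} on vertex set Fin n, stored canonically as (u , v) with u < v.
Edge : ℕ → Set
Edge n = Fin n × Fin n

record SimpleGraph (n : ℕ) : Set where
  field
    edges     : List (Edge n)
    canonical : All (λ e → Data.Product.proj₁ e < Data.Product.proj₂ e) edges
    distinct  : Unique edges

disjointᵇ : ∀ {n} → Edge n → Edge n → Bool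
disjointᵇ (a , b) (c , d) =
  not ⌊ a ≟ c ⌋ ∧ not ⌊ a ≟ d ⌋ ∧ not ⌊ b ≟ c ⌋ ∧ not ⌊ b ≟ d ⌋

isMatchingᵇ : ∀ {n} → List (Edge n) → Bool
isMatchingᵇ [] = true
isMatchingᵇ (e ∷ es) = foldr (λ f r → disjointᵇ e f ∧ r) true es ∧ isMatchingᵇ es

sublists : ∀ {A : Set} → List A → List (List A)
sublists [] = [ [] ]
sublists (x ∷ xs) = map (x ∷_) (sublists xs) ++ sublists xs

μ : ∀ {n} → List (Edge n) → ℕ
μ es = foldr (λ s r → (if isMatchingᵇ s then length s else 0) ⊔ r) 0 (sublists es)
  where open import Data.Bool using (if_then_else_)

-- All orderings (permutations) of a list, each listed once per arrangement of positions.
insertions : ∀ {A : Set} → A → List A → List (List A)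
insertions x [] = [ x ∷ [] ]
insertions x (y ∷ ys) = (x ∷ y ∷ ys) ∷ map (y ∷_) (insertions x ys)

permutations : ∀ {A : Set} → List A → List (List A)
permutations [] = [ [] ]
permutations (x ∷ xs) = concatMap (insertions x) (permutations xs)

count : ∀ {A : Set} → (A → Bool) → List A → ℕ
count p [] = 0
count p (x ∷ xs) = (if p x then 1 else 0) ℕ.+ count p xs
  where open import Data.Bool using (if_then_else_)

ℕ→ℚ : ℕ → ℚ
ℕ→ℚ k = + k / 1

expTerm : ℕ → ℚ → ℚ
expTerm zero x = 1ℚ
expTerm (suc j) x = expTerm j x ℚ.* x ℚ.* (+ 1 / suc j)

expPartial : ℕ → ℚ → ℚ
expPartial zero x = 1ℚ
expPartial (suc j) x = expPartial j x ℚ.+ expTerm (suc j) x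

-- "N ≤ exp x" for rational x ≥ 0, via exp x = sup_j expPartial j x.
-- (For rational x > 0, exp x is irrational, so N ≤ exp x iff N ≤ some partial sum;
--  for x = 0 the zeroth partial sum is exactly 1 = exp 0.)
AtMostExp : ℕ → ℚ → Set
AtMostExp N x = ∃ λ j → ℕ→ℚ N ℚ.≤ expPartial j x

⌊_⌋ℕ : ℚ → ℕ
⌊ q ⌋ℕ = ∣ ℚ.floor q ∣

late : ∀ {n} → ℚ → List (Edge n) → List (Edge n)
late ε s = drop ⌊ ε ℚ.* ℕ→ℚ (length s) ⌋ℕ s

module Submission where

-- Fix a maximum matching M of G, let μ = |M|, write ε = P/Q and let k = ⌊εm⌋ be the
-- number of early edges. The M-edges among the late edges form a matching of the late
-- graph, so an ordering can only be bad if at least r > 2εμ edges of M lie among its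
-- first k edges. Double counting pairs (ordering, t-subset of M inside the prefix), where
-- a fixed t-subset lies in the prefix of exactly k⋯(k−t+1)·(m−t)! orderings, gives
-- #bad · C(r,t) ≤ C(μ,t) · k⋯(k−t+1) · (m−t)!. For t = ⌊r/4⌋ + 1 every factor
-- (μ−i)(k−i)/((r−i)(m−i)) is at most 2/3, so #bad ≤ (2/3)ᵗ · m!, and (3/2)ᵗ ≥ n⁵ because
-- με² ≤ t turns the hypothesis into n²⁰ ≤ exp(με²) ≤ 2·4ᵗ.

open import Data.Bool using (Bool; true; false; if_then_else_; not; _∧_; T)
open import Data.Bool.Properties using (T-∧)
open import Data.Empty using (⊥-elim)
open import Data.Fin as Fin using (Fin)
open import Data.Integer as ℤ using (+≤+; +<+)
import Data.Integer.DivMod as ℤ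
import Data.Integer.Properties as ℤ
open import Data.List using (List; []; _∷_; _++_; length; map; concatMap; take; drop; foldr; filter)
open import Data.List.Membership.Propositional using (_∈_; _∉_)
open import Data.List.Membership.Propositional.Properties
  using (∈-++⁻; ∈-++⁺ˡ; ∈-++⁺ʳ; ∈-map⁺; ∈-map⁻; ∈-filter⁺; ∈-filter⁻)
open import Data.List.Properties using (length-map; length-++; take++drop≡id)
open import Data.List.Relation.Binary.Permutation.Propositional
  using (_↭_; ↭-refl; ↭-prep; ↭-swap; ↭-trans; ↭-sym; ↭⇒↭ₛ)
open import Data.List.Relation.Binary.Permutation.Propositional.Properties using (↭-length; ∈-resp-↭)
import Data.List.Relation.Binary.Permutation.Setoid.Properties as ↭ₛ
open import Data.List.Relation.Binary.Sublist.Propositional using (_⊆_; []; _∷ʳ_; _∷_; ⊆-trans; minimum)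
open import Data.List.Relation.Binary.Sublist.Propositional.Properties
  using (Any-resp-⊆; All-resp-⊆; take-⊆; length-mono-≤)
open import Data.List.Relation.Unary.All as All using (All; []; _∷_)
import Data.List.Relation.Unary.All.Properties as All
open import Data.List.Relation.Unary.AllPairs using (AllPairs; []; _∷_)
open import Data.List.Relation.Unary.Any using (here; there)
open import Data.List.Relation.Unary.Unique.Propositional using (Unique)
open import Data.List.Relation.Unary.Unique.Propositional.Properties using (Unique[x∷xs]⇒x∉xs)
import Data.List.Relation.Unary.Unique.Propositional.Properties as Unique
open import Data.Nat as ℕ
open import Data.Nat.Combinatorics
  using (_C_; nCk+nC[k+1]≡[n+1]C[k+1]; k>n⇒nCk≡0; nCk≡nPk/k!; [n-k]*[n-k-1]!≡[n-k]!; nCn≡1)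
import Data.Nat.Combinatorics as Combinatorics
open import Data.Nat.Combinatorics.Base using (_P′_)
open import Data.Nat.Combinatorics.Specification using (k!∣nP′k; nP′k≡n[n∸1P′k∸1])
open import Data.Nat.DivMod using (_/_; _%_; m/n*n≡m; m/n*n≤m; m≡m%n+[m/n]*n; m%n<n; m/n<m; m<n*o⇒m/o<n)
open import Data.Nat.Properties
open import Data.Nat.Tactic.RingSolver using (solve-∀)
open import Data.Product using (_×_; _,_; proj₁; proj₂; ∃; ∃₂)
open import Data.Product.Properties using (≡-dec)
open import Data.Rational as ℚ using (ℚ; mkℚ; 0ℚ; 1ℚ; ½)
import Data.Rational.Properties as ℚ
open import Data.Rational.Unnormalised as ℚᵘ using (ℚᵘ; mkℚᵘ; *≤*; *<*)
import Data.Rational.Unnormalised.Properties as ℚᵘ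
open import Data.Sum as Sum using (_⊎_; inj₁; inj₂)
open import Function using (id; _⇔_; mk⇔; Equivalence)
open import Relation.Binary.Definitions using (DecidableEquality)
open import Relation.Binary.PropositionalEquality
open import Relation.Nullary using (Dec; yes; no; does; ¬_)
open import Relation.Nullary.Decidable using (⌊_⌋; does-⇔; dec-false; isYes≗does)

open import Defs

private variable
  X Y : Set

∑ : (X → ℕ) → List X → ℕ
∑ f [] = 0
∑ f (x ∷ xs) = f x + ∑ f xs

ind : Bool → ℕ
ind b = if b then 1 else 0

count≡∑ind : (p : X → Bool) (xs : List X) → count p xs ≡ ∑ (λ x → ind (p x)) xs
count≡∑ind p [] = refl
count≡∑ind p (x ∷ xs) = cong (ind (p x) +_) (count≡∑ind p xs)

∑-++ : (f : X → ℕ) (xs ys : List X) → ∑ f (xs ++ ys) ≡ ∑ f xs + ∑ f ys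
∑-++ f [] ys = refl
∑-++ f (x ∷ xs) ys = trans (cong (f x +_) (∑-++ f xs ys)) (sym (+-assoc (f x) _ _))

∑-map : (f : Y → ℕ) (g : X → Y) (xs : List X) → ∑ f (map g xs) ≡ ∑ (λ x → f (g x)) xs
∑-map f g [] = refl
∑-map f g (x ∷ xs) = cong (f (g x) +_) (∑-map f g xs)

∑-concatMap : (f : Y → ℕ) (g : X → List Y) (xs : List X) →
  ∑ f (concatMap g xs) ≡ ∑ (λ x → ∑ f (g x)) xs
∑-concatMap f g [] = refl
∑-concatMap f g (x ∷ xs) =
  trans (∑-++ f (g x) (concatMap g xs)) (cong (∑ f (g x) +_) (∑-concatMap f g xs))

∑-cong : {P : X → Set} {f g : X → ℕ} {xs : List X} →
  All P xs → (∀ {x} → P x → f x ≡ g x) → ∑ f xs ≡ ∑ g xs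
∑-cong [] h = refl
∑-cong (p ∷ ps) h = cong₂ _+_ (h p) (∑-cong ps h)

∑-mono-≤ : {P : X → Set} {f g : X → ℕ} {xs : List X} →
  All P xs → (∀ {x} → P x → f x ≤ g x) → ∑ f xs ≤ ∑ g xs
∑-mono-≤ [] h = ≤-refl
∑-mono-≤ (p ∷ ps) h = +-mono-≤ (h p) (∑-mono-≤ ps h)

∑-const : (c : ℕ) (xs : List X) → ∑ (λ _ → c) xs ≡ length xs * c
∑-const c [] = refl
∑-const c (x ∷ xs) = cong (c +_) (∑-const c xs)

∑-+ : (f g : X → ℕ) (xs : List X) → ∑ (λ x → f x + g x) xs ≡ ∑ f xs + ∑ g xs
∑-+ f g [] = refl
∑-+ f g (x ∷ xs) rewrite ∑-+ f g xs = interchange (f x) (g x) (∑ f xs) (∑ g xs)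
  where open import Algebra.Properties.CommutativeSemigroup +-commutativeSemigroup using (interchange)

∑-*ˡ : (a : ℕ) (f : X → ℕ) (xs : List X) → ∑ (λ x → a * f x) xs ≡ a * ∑ f xs
∑-*ˡ a f [] = sym (*-zeroʳ a)
∑-*ˡ a f (x ∷ xs) =
  trans (cong (a * f x +_) (∑-*ˡ a f xs)) (sym (*-distribˡ-+ a (f x) (∑ f xs)))

∑-comm : (h : X → Y → ℕ) (xs : List X) (ys : List Y) →
  ∑ (λ x → ∑ (h x) ys) xs ≡ ∑ (λ y → ∑ (λ x → h x y) xs) ys
∑-comm h [] ys = sym (trans (∑-const 0 ys) (*-zeroʳ (length ys)))
∑-comm h (x ∷ xs) ys = trans (cong (∑ (h x) ys +_) (∑-comm h xs ys)) (sym (∑-+ (h x) _ ys))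

count-++ : (p : X → Bool) (xs ys : List X) → count p (xs ++ ys) ≡ count p xs + count p ys
count-++ p [] ys = refl
count-++ p (x ∷ xs) ys =
  trans (cong (ind (p x) +_) (count-++ p xs ys)) (sym (+-assoc (ind (p x)) _ _))

count-map : (p : Y → Bool) (f : X → Y) (xs : List X) →
  count p (map f xs) ≡ count (λ x → p (f x)) xs
count-map p f [] = refl
count-map p f (x ∷ xs) = cong (ind (p (f x)) +_) (count-map p f xs)

count-false : (xs : List X) → count (λ _ → false) xs ≡ 0
count-false [] = refl
count-false (_ ∷ xs) = count-false xs

count+count-not≡length : (p : X → Bool) (xs : List X) →
  count p xs + count (λ x → not (p x)) xs ≡ length xs
count+count-not≡length p [] = refl
count+count-not≡length p (x ∷ xs) with p x
... | true = cong suc (count+count-not≡length p xs)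
... | false = trans (+-suc _ _) (cong suc (count+count-not≡length p xs))

count*≤∑ : {P : X → Set} {p : X → Bool} {f : X → ℕ} {c : ℕ} {xs : List X} →
  All P xs → (∀ {x} → P x → T (p x) → c ≤ f x) → count p xs * c ≤ ∑ f xs
count*≤∑ [] _ = z≤n
count*≤∑ {p = p} {f} {c} {x ∷ _} (px ∷ pxs) c≤f with p x in eq
... | true = +-mono-≤ (c≤f px (subst T (sym eq) _)) (count*≤∑ pxs c≤f)
... | false = ≤-trans (count*≤∑ pxs c≤f) (m≤n+m _ (f x))

T-not⌊⌋⇒¬ : {A : Set} (a? : Dec A) → T (not ⌊ a? ⌋) → ¬ A
T-not⌊⌋⇒¬ (yes _) ()
T-not⌊⌋⇒¬ (no ¬a) _ = ¬a

-- Binomial coefficients and falling factorials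

C-monoˡ-≤ : ∀ {m n} k → m ≤ n → m C k ≤ n C k
C-monoˡ-≤ zero _ = ≤-refl
C-monoˡ-≤ {m} {zero} (suc k) z≤n = ≤-refl
C-monoˡ-≤ {m} {suc n} (suc k) m≤1+n with m ≟ suc n
... | yes refl = ≤-refl
... | no m≢1+n = begin
  m C suc k                 ≤⟨ C-monoˡ-≤ (suc k) (≤-pred (≤∧≢⇒< m≤1+n m≢1+n)) ⟩
  n C suc k                 ≤⟨ m≤n+m (n C suc k) (n C k) ⟩
  n C k + n C suc k         ≡⟨ nCk+nC[k+1]≡[n+1]C[k+1] n k ⟩
  suc n C suc k             ∎
  where open ≤-Reasoning

k>n⇒nP′k≡0 : ∀ {n k} → n < k → n P′ k ≡ 0
k>n⇒nP′k≡0 {n} {suc k} (s≤s n≤k) = cong (_* (n P′ k)) (m≤n⇒m∸n≡0 n≤k)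

nP′k>0 : ∀ {n k} → k ≤ n → 0 < n P′ k
nP′k>0 {n} {zero} _ = s≤s z≤n
nP′k>0 {n} {suc k} k<n = *-mono-< (m<n⇒0<n∸m k<n) (nP′k>0 (<⇒≤ k<n))

nP′[1+k]≡n*[n∸1]P′k : ∀ n k → n P′ suc k ≡ n * (pred n P′ k)
nP′[1+k]≡n*[n∸1]P′k zero k = cong (_* (0 P′ k)) (0∸n≡0 k)
nP′[1+k]≡n*[n∸1]P′k (suc n) k = nP′k≡n[n∸1P′k∸1] (suc n) (suc k)

nP′k*[n∸k]!≡n! : ∀ {n k} → k ≤ n → (n P′ k) * (n ∸ k) ! ≡ n !
nP′k*[n∸k]!≡n! {n} {zero} _ = *-identityˡ (n !)
nP′k*[n∸k]!≡n! {n} {suc k} k<n = begin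
  (n ∸ k) * (n P′ k) * (n ∸ suc k) !   ≡⟨ reorder (n ∸ k) (n P′ k) ((n ∸ suc k) !) ⟩
  (n P′ k) * ((n ∸ k) * (n ∸ suc k) !) ≡⟨ cong ((n P′ k) *_) ([n-k]*[n-k-1]!≡[n-k]! k<n) ⟩
  (n P′ k) * (n ∸ k) !                 ≡⟨ nP′k*[n∸k]!≡n! (<⇒≤ k<n) ⟩
  n !                                  ∎
  where
  open ≡-Reasoning
  reorder : ∀ a b c → a * b * c ≡ b * (a * c)
  reorder = solve-∀

nPk≡nP′k : ∀ {n k} → k ≤ n → n Combinatorics.P k ≡ n P′ k
nPk≡nP′k {n} {k} k≤n with k ≤ᵇ n | ≤⇒≤ᵇ k≤n
... | true | _ = refl

nCk*k!≡nP′k : ∀ n k → (n C k) * k ! ≡ n P′ k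
nCk*k!≡nP′k n k with k ≤? n
... | yes k≤n = begin
  (n C k) * k !                       ≡⟨ cong (_* k !) (nCk≡nPk/k! k≤n) ⟩
  ((n Combinatorics.P k) / k !) * k ! ≡⟨ cong (λ z → (z / k !) * k !) (nPk≡nP′k k≤n) ⟩
  ((n P′ k) / k !) * k !              ≡⟨ m/n*n≡m (k!∣nP′k k≤n) ⟩
  n P′ k                              ∎
  where
  open ≡-Reasoning
  instance _ = k !≢0
... | no k≰n = trans (cong (_* k !) (k>n⇒nCk≡0 (≰⇒> k≰n))) (sym (k>n⇒nP′k≡0 (≰⇒> k≰n)))

[1+k]*[1+n]C[1+k]≡[1+n]*nCk : ∀ n k → suc k * (suc n C suc k) ≡ suc n * (n C k)
[1+k]*[1+n]C[1+k]≡[1+n]*nCk n k = *-cancelʳ-≡ _ _ (k !) {{k !≢0}} (begin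
  suc k * (suc n C suc k) * k !   ≡⟨ reorder (suc k) (suc n C suc k) (k !) ⟩
  (suc n C suc k) * (suc k * k !) ≡⟨ nCk*k!≡nP′k (suc n) (suc k) ⟩
  suc n P′ suc k                  ≡⟨ nP′[1+k]≡n*[n∸1]P′k (suc n) k ⟩
  suc n * (n P′ k)                ≡⟨ cong (suc n *_) (nCk*k!≡nP′k n k) ⟨
  suc n * ((n C k) * k !)         ≡⟨ *-assoc (suc n) (n C k) (k !) ⟨
  suc n * (n C k) * k !           ∎)
  where
  open ≡-Reasoning
  reorder : ∀ a b c → a * b * c ≡ b * (a * c)
  reorder = solve-∀

[m∸n]+[o∸m]≡o∸n : ∀ {m n o} → n ≤ m → m ≤ o → (m ∸ n) + (o ∸ m) ≡ o ∸ n
[m∸n]+[o∸m]≡o∸n {m} {zero} _ m≤o = m+[n∸m]≡n m≤o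
[m∸n]+[o∸m]≡o∸n {suc m} {suc n} {suc o} (s≤s n≤m) (s≤s m≤o) = [m∸n]+[o∸m]≡o∸n n≤m m≤o

P′-insertion-identity : ∀ k t j → t ≤ j → k ≤ suc j →
  k * (pred k P′ t) * (j ∸ t) ! + (suc j ∸ k) * ((k P′ t) * (j ∸ t) !) ≡ (k P′ t) * (suc j ∸ t) !
P′-insertion-identity k t j t≤j k≤1+j = begin
  k * (pred k P′ t) * F + (suc j ∸ k) * ((k P′ t) * F)
    ≡⟨ cong (λ z → z * F + (suc j ∸ k) * ((k P′ t) * F)) (sym (nP′[1+k]≡n*[n∸1]P′k k t)) ⟩
  (k ∸ t) * (k P′ t) * F + (suc j ∸ k) * ((k P′ t) * F)
    ≡⟨ factor (k ∸ t) (k P′ t) F (suc j ∸ k) ⟩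
  (k P′ t) * (((k ∸ t) + (suc j ∸ k)) * F)
    ≡⟨ collapse (t ≤? k) ⟩
  (k P′ t) * (suc j ∸ t) ! ∎
  where
  open ≡-Reasoning
  F = (j ∸ t) !
  factor : ∀ a p f b → a * p * f + b * (p * f) ≡ p * ((a + b) * f)
  factor = solve-∀
  collapse : Dec (t ≤ k) → (k P′ t) * (((k ∸ t) + (suc j ∸ k)) * F) ≡ (k P′ t) * (suc j ∸ t) !
  collapse (yes t≤k) rewrite [m∸n]+[o∸m]≡o∸n t≤k k≤1+j | +-∸-assoc 1 t≤j = refl
  collapse (no t≰k) rewrite k>n⇒nP′k≡0 (≰⇒> t≰k) = refl

-- negBinomialSum N j = 2ʲ · ∑_{i ≤ j} C(N+i, i) / 2ⁱ, a partial sum of ∑ᵢ C(N+i, i) / 2ⁱ = 2ᴺ⁺¹.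

negBinomialSum : ℕ → ℕ → ℕ
negBinomialSum N zero = 1
negBinomialSum N (suc j) = 2 * negBinomialSum N j + (N + suc j) C suc j

negBinomialSum-suc : ∀ N j → negBinomialSum (suc N) j + (suc N + j) C j ≡ 2 * negBinomialSum N j
negBinomialSum-suc N zero = refl
negBinomialSum-suc N (suc j) = begin
  2 * S′ + c′ + c′                      ≡⟨ cong (λ z → 2 * S′ + z + z) pascal ⟩
  2 * S′ + (c + c₀) + (c + c₀)          ≡⟨ regroup S′ c c₀ ⟩
  2 * (S′ + c) + 2 * c₀                 ≡⟨ cong (λ z → 2 * z + 2 * c₀) (negBinomialSum-suc N j) ⟩
  2 * (2 * negBinomialSum N j) + 2 * c₀ ≡⟨ *-distribˡ-+ 2 (2 * negBinomialSum N j) c₀ ⟨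
  2 * (2 * negBinomialSum N j + c₀)     ∎
  where
  open ≡-Reasoning
  S′ = negBinomialSum (suc N) j
  c = (suc N + j) C j
  c′ = (suc N + suc j) C suc j
  c₀ = (N + suc j) C suc j
  pascal : c′ ≡ c + c₀
  pascal rewrite +-suc N j = sym (nCk+nC[k+1]≡[n+1]C[k+1] (suc N + j) j)
  regroup : ∀ S c c₀ → 2 * S + (c + c₀) + (c + c₀) ≡ 2 * (S + c) + 2 * c₀
  regroup = solve-∀

negBinomialSum≤ : ∀ N j → negBinomialSum N j ≤ 2 ^ N * (2 * 2 ^ j)
negBinomialSum≤ zero j = ≤-trans (m≤m+n _ 1) (≤-trans (base j) (≤-reflexive (sym (+-identityʳ _))))
  where
  base : ∀ j → negBinomialSum 0 j + 1 ≤ 2 * 2 ^ j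
  base zero = ≤-refl
  base (suc j) rewrite nCn≡1 (suc j) =
    ≤-trans (≤-reflexive (double (negBinomialSum 0 j))) (*-monoʳ-≤ 2 (base j))
    where
    double : ∀ a → 2 * a + 1 + 1 ≡ 2 * (a + 1)
    double = solve-∀
negBinomialSum≤ (suc N) j = begin
  negBinomialSum (suc N) j                   ≤⟨ m≤m+n _ _ ⟩
  negBinomialSum (suc N) j + (suc N + j) C j ≡⟨ negBinomialSum-suc N j ⟩
  2 * negBinomialSum N j                     ≤⟨ *-monoʳ-≤ 2 (negBinomialSum≤ N j) ⟩
  2 * (2 ^ N * (2 * 2 ^ j))                  ≡⟨ *-assoc 2 (2 ^ N) _ ⟨
  2 ^ suc N * (2 * 2 ^ j)                    ∎
  where open ≤-Reasoning

-- Permutations and insertion positions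

insertAt : ℕ → X → List X → List X
insertAt i x ys = take i ys ++ x ∷ drop i ys

insertions-↭ : (x : X) (s : List X) → All (_↭ x ∷ s) (insertions x s)
insertions-↭ x [] = ↭-refl ∷ []
insertions-↭ x (y ∷ s) =
  ↭-refl ∷ All.map⁺ (All.map (λ p → ↭-trans (↭-prep y p) (↭-swap y x ↭-refl)) (insertions-↭ x s))

permutations-↭ : (ys : List X) → All (_↭ ys) (permutations ys)
permutations-↭ [] = ↭-refl ∷ []
permutations-↭ (x ∷ ys) = All.concat⁺ (All.map⁺ (All.map
  (λ s↭ys → All.map (λ p → ↭-trans p (↭-prep x s↭ys)) (insertions-↭ x _))
  (permutations-↭ ys)))

length-insertions : (x : X) (s : List X) → length (insertions x s) ≡ suc (length s)
length-insertions x [] = refl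
length-insertions x (y ∷ s) =
  cong suc (trans (length-map (y ∷_) (insertions x s)) (length-insertions x s))

length-permutations : (ys : List X) → length (permutations ys) ≡ length ys !
length-permutations [] = refl
length-permutations (x ∷ ys) = begin
  length (concatMap (insertions x) (permutations ys))
    ≡⟨ length-concatMap (insertions x) (permutations ys) ⟩
  ∑ (λ s → length (insertions x s)) (permutations ys)
    ≡⟨ ∑-cong (permutations-↭ ys) (λ {s} p → trans (length-insertions x s) (cong suc (↭-length p))) ⟩
  ∑ (λ _ → suc (length ys)) (permutations ys)
    ≡⟨ ∑-const (suc (length ys)) (permutations ys) ⟩
  length (permutations ys) * suc (length ys)
    ≡⟨ cong (_* suc (length ys)) (length-permutations ys) ⟩
  length ys ! * suc (length ys)
    ≡⟨ *-comm (length ys !) (suc (length ys)) ⟩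
  suc (length ys) ! ∎
  where
  open ≡-Reasoning
  length-concatMap : (g : X → List Y) (xs : List X) →
    length (concatMap g xs) ≡ ∑ (λ x → length (g x)) xs
  length-concatMap g [] = refl
  length-concatMap g (x ∷ xs) =
    trans (length-++ (g x)) (cong (length (g x) +_) (length-concatMap g xs))

∑< : ℕ → (ℕ → ℕ) → ℕ
∑< zero f = 0
∑< (suc n) f = f 0 + ∑< n (λ i → f (suc i))

∑-insertions : (g : List X → ℕ) (x : X) (s : List X) →
  ∑ g (insertions x s) ≡ ∑< (suc (length s)) (λ i → g (insertAt i x s))
∑-insertions g x [] = refl
∑-insertions g x (y ∷ s) = cong (g (x ∷ y ∷ s) +_)
  (trans (∑-map g (y ∷_) (insertions x s)) (∑-insertions (λ z → g (y ∷ z)) x s))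

∑<-two-valued : ∀ {n k a b} (f : ℕ → ℕ) → k ≤ n →
  (∀ {i} → i < k → f i ≡ a) → (∀ {i} → k ≤ i → i < n → f i ≡ b) →
  ∑< n f ≡ k * a + (n ∸ k) * b
∑<-two-valued {zero} {zero} f _ _ _ = refl
∑<-two-valued {suc n} {zero} {a} f _ _ f≡b = cong₂ _+_ (f≡b z≤n (s≤s z≤n))
  (∑<-two-valued {k = 0} {a = a} (λ i → f (suc i)) z≤n (λ ()) (λ _ i<n → f≡b z≤n (s≤s i<n)))
∑<-two-valued {suc n} {suc k} {a} f (s≤s k≤n) f≡a f≡b = trans
  (cong₂ _+_ (f≡a (s≤s z≤n)) (∑<-two-valued (λ i → f (suc i)) k≤n
    (λ i<k → f≡a (s≤s i<k)) (λ k≤i i<n → f≡b (s≤s k≤i) (s≤s i<n))))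
  (sym (+-assoc a (k * a) _))

module _ {x : X} where

  take-insertAt-≥ : ∀ k i s → k ≤ i → i ≤ length s → take k (insertAt i x s) ≡ take k s
  take-insertAt-≥ zero i s _ _ = refl
  take-insertAt-≥ (suc k) (suc i) (y ∷ s) (s≤s k≤i) (s≤s i≤s) =
    cong (y ∷_) (take-insertAt-≥ k i s k≤i i≤s)

  ∈-take-insertAt⁻ : ∀ {e} k i s → i < k → i ≤ length s →
    e ∈ take k (insertAt i x s) → e ≡ x ⊎ e ∈ take (pred k) s
  ∈-take-insertAt⁻ (suc k) zero s _ _ (here e≡x) = inj₁ e≡x
  ∈-take-insertAt⁻ (suc k) zero s _ _ (there e∈s) = inj₂ e∈s
  ∈-take-insertAt⁻ (suc zero) (suc i) s (s≤s ()) _ _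
  ∈-take-insertAt⁻ (suc (suc k)) (suc i) (y ∷ s) _ _ (here e≡y) = inj₂ (here e≡y)
  ∈-take-insertAt⁻ (suc (suc k)) (suc i) (y ∷ s) (s≤s i<k) (s≤s i≤s) (there e∈) =
    Sum.map₂ there (∈-take-insertAt⁻ (suc k) i s i<k i≤s e∈)

  ∈-take-insertAt⁺ : ∀ {e} k i s → i < k → i ≤ length s →
    e ≡ x ⊎ e ∈ take (pred k) s → e ∈ take k (insertAt i x s)
  ∈-take-insertAt⁺ (suc k) zero s _ _ (inj₁ e≡x) = here e≡x
  ∈-take-insertAt⁺ (suc k) zero s _ _ (inj₂ e∈s) = there e∈s
  ∈-take-insertAt⁺ (suc (suc k)) (suc i) (y ∷ s) (s≤s i<k) (s≤s i≤s) (inj₁ e≡x) =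
    there (∈-take-insertAt⁺ (suc k) i s i<k i≤s (inj₁ e≡x))
  ∈-take-insertAt⁺ (suc (suc k)) (suc i) (y ∷ s) _ _ (inj₂ (here e≡y)) = here e≡y
  ∈-take-insertAt⁺ (suc (suc k)) (suc i) (y ∷ s) (s≤s i<k) (s≤s i≤s) (inj₂ (there e∈)) =
    there (∈-take-insertAt⁺ (suc k) i s i<k i≤s (inj₂ e∈))

count-permutations-∷-two-valued : ∀ {x : X} {ys k} (p a b : List X → Bool) → k ≤ suc (length ys) →
  (∀ {s i} → s ↭ ys → i < k → i ≤ length s → p (insertAt i x s) ≡ a s) →
  (∀ {s i} → s ↭ ys → k ≤ i → i ≤ length s → p (insertAt i x s) ≡ b s) →
  count p (permutations (x ∷ ys)) ≡ k * count a (permutations ys) + (suc (length ys) ∸ k) * count b (permutations ys)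
count-permutations-∷-two-valued {x = x} {ys} {k} p a b k≤1+ys p≡a p≡b = begin
  count p (permutations (x ∷ ys))
    ≡⟨ count≡∑ind p (permutations (x ∷ ys)) ⟩
  ∑ (λ s → ind (p s)) (concatMap (insertions x) (permutations ys))
    ≡⟨ ∑-concatMap (λ s → ind (p s)) (insertions x) (permutations ys) ⟩
  ∑ (λ s → ∑ (λ s′ → ind (p s′)) (insertions x s)) (permutations ys)
    ≡⟨ ∑-cong (permutations-↭ ys) per-permutation ⟩
  ∑ (λ s → k * ind (a s) + l * ind (b s)) (permutations ys)
    ≡⟨ ∑-+ _ _ (permutations ys) ⟩
  ∑ (λ s → k * ind (a s)) (permutations ys) + ∑ (λ s → l * ind (b s)) (permutations ys)
    ≡⟨ cong₂ _+_ (∑-*ˡ k _ (permutations ys)) (∑-*ˡ l _ (permutations ys)) ⟩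
  k * ∑ (λ s → ind (a s)) (permutations ys) + l * ∑ (λ s → ind (b s)) (permutations ys)
    ≡⟨ cong₂ (λ u v → k * u + l * v) (count≡∑ind a (permutations ys)) (count≡∑ind b (permutations ys)) ⟨
  k * count a (permutations ys) + l * count b (permutations ys) ∎
  where
  open ≡-Reasoning
  l = suc (length ys) ∸ k
  per-permutation : ∀ {s} → s ↭ ys → ∑ (λ s′ → ind (p s′)) (insertions x s) ≡ k * ind (a s) + l * ind (b s)
  per-permutation {s} s↭ys rewrite ∑-insertions (λ s′ → ind (p s′)) x s | ↭-length s↭ys =
    ∑<-two-valued _ k≤1+ys
      (λ i<k → cong ind (p≡a s↭ys i<k (i≤s (≤-trans i<k k≤1+ys))))
      (λ k≤i i<1+ys → cong ind (p≡b s↭ys k≤i (i≤s i<1+ys)))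
    where
    i≤s : ∀ {i} → i < suc (length ys) → i ≤ length s
    i≤s i<1+ys = ≤-trans (≤-pred i<1+ys) (≤-reflexive (sym (↭-length s↭ys)))

combinations : ℕ → List X → List (List X)
combinations zero xs = [] ∷ []
combinations (suc t) [] = []
combinations (suc t) (x ∷ xs) = map (x ∷_) (combinations t xs) ++ combinations (suc t) xs

combinations-⊆ : ∀ t (xs : List X) → All (λ T → T ⊆ xs × length T ≡ t) (combinations t xs)
combinations-⊆ zero [] = ([] , refl) ∷ []
combinations-⊆ zero (x ∷ xs) with (T⊆xs , ∣T∣≡0) ∷ [] ← combinations-⊆ zero xs =
  (x ∷ʳ T⊆xs , ∣T∣≡0) ∷ []
combinations-⊆ (suc t) [] = []
combinations-⊆ (suc t) (x ∷ xs) = All.++⁺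
  (All.map⁺ (All.map (λ (T⊆xs , ∣T∣≡t) → refl ∷ T⊆xs , cong suc ∣T∣≡t) (combinations-⊆ t xs)))
  (All.map (λ (T⊆xs , ∣T∣≡1+t) → x ∷ʳ T⊆xs , ∣T∣≡1+t) (combinations-⊆ (suc t) xs))

length-combinations : ∀ t (xs : List X) → length (combinations t xs) ≡ length xs C t
length-combinations zero xs = refl
length-combinations (suc t) [] = refl
length-combinations (suc t) (x ∷ xs) = begin
  length (map (x ∷_) (combinations t xs) ++ combinations (suc t) xs)
    ≡⟨ length-++ (map (x ∷_) (combinations t xs)) ⟩
  length (map (x ∷_) (combinations t xs)) + length (combinations (suc t) xs)
    ≡⟨ cong₂ _+_ (trans (length-map (x ∷_) (combinations t xs)) (length-combinations t xs))
                 (length-combinations (suc t) xs) ⟩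
  length xs C t + length xs C suc t
    ≡⟨ nCk+nC[k+1]≡[n+1]C[k+1] (length xs) t ⟩
  suc (length xs) C suc t ∎
  where open ≡-Reasoning

count-all-combinations : {P : X → Set} (P? : ∀ x → Dec (P x)) → ∀ t xs →
  count (λ T → does (All.all? P? T)) (combinations t xs) ≡ count (λ x → does (P? x)) xs C t
count-all-combinations P? zero xs = refl
count-all-combinations P? (suc t) [] = refl
count-all-combinations P? (suc t) (x ∷ xs) = begin
  count allP? (map (x ∷_) (combinations t xs) ++ combinations (suc t) xs)
    ≡⟨ count-++ allP? (map (x ∷_) (combinations t xs)) (combinations (suc t) xs) ⟩
  count allP? (map (x ∷_) (combinations t xs)) + count allP? (combinations (suc t) xs)
    ≡⟨ cong₂ _+_ (count-map allP? (x ∷_) (combinations t xs)) (count-all-combinations P? (suc t) xs) ⟩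
  count (λ T → does (P? x) ∧ allP? T) (combinations t xs) + c C suc t
    ≡⟨ by-cases (does (P? x)) ⟩
  count (λ x → does (P? x)) (x ∷ xs) C suc t ∎
  where
  open ≡-Reasoning
  allP? = λ T → does (All.all? P? T)
  c = count (λ x → does (P? x)) xs
  by-cases : (b : Bool) → count (λ T → b ∧ allP? T) (combinations t xs) + c C suc t ≡ (ind b + c) C suc t
  by-cases true = trans (cong (_+ c C suc t) (count-all-combinations P? t xs)) (nCk+nC[k+1]≡[n+1]C[k+1] c t)
  by-cases false = cong (_+ c C suc t) (count-false (combinations t xs))

Unique-resp-↭ : {xs ys : List X} → xs ↭ ys → Unique xs → Unique ys
Unique-resp-↭ {X} xs↭ys = ↭ₛ.Unique-resp-↭ (setoid X) (↭⇒↭ₛ xs↭ys)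

AllPairs-resp-⊆ : {R : X → X → Set} {xs ys : List X} → xs ⊆ ys → AllPairs R ys → AllPairs R xs
AllPairs-resp-⊆ [] [] = []
AllPairs-resp-⊆ (y ∷ʳ xs⊆ys) (_ ∷ pys) = AllPairs-resp-⊆ xs⊆ys pys
AllPairs-resp-⊆ (refl ∷ xs⊆ys) (px ∷ pys) = All-resp-⊆ xs⊆ys px ∷ AllPairs-resp-⊆ xs⊆ys pys

module _ (_≟_ : DecidableEquality X) where

  private
    remove : X → List X → List X
    remove x [] = []
    remove x (y ∷ ys) with x ≟ y
    ... | yes _ = ys
    ... | no _ = y ∷ remove x ys

    length-remove : ∀ {x} ys → x ∈ ys → suc (length (remove x ys)) ≡ length ys
    length-remove {x} (y ∷ ys) x∈ with x ≟ y | x∈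
    ... | yes _ | _ = refl
    ... | no x≢y | here x≡y = ⊥-elim (x≢y x≡y)
    ... | no _ | there x∈ys = cong suc (length-remove ys x∈ys)

    ∈-remove : ∀ {x e} ys → e ∈ ys → x ≢ e → e ∈ remove x ys
    ∈-remove {x} (y ∷ ys) e∈ x≢e with x ≟ y | e∈
    ... | yes refl | here refl = ⊥-elim (x≢e refl)
    ... | yes refl | there e∈ys = e∈ys
    ... | no _ | here e≡y = here e≡y
    ... | no _ | there e∈ys = there (∈-remove ys e∈ys x≢e)

  Unique⇒length≤ : {xs ys : List X} → Unique xs → All (_∈ ys) xs → length xs ≤ length ys
  Unique⇒length≤ {[]} _ _ = z≤n
  Unique⇒length≤ {x ∷ xs} {ys} (x≢xs ∷ uxs) (x∈ys ∷ xs⊆ys) =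
    subst (suc (length xs) ≤_) (length-remove ys x∈ys) (s≤s (Unique⇒length≤ uxs
      (All.zipWith (λ (x≢e , e∈ys) → ∈-remove ys e∈ys x≢e) (x≢xs , xs⊆ys))))

∈-sublists⇒⊆ : {W xs : List X} → W ∈ sublists xs → W ⊆ xs
∈-sublists⇒⊆ {xs = []} (here refl) = []
∈-sublists⇒⊆ {xs = x ∷ xs} W∈ with ∈-++⁻ (map (x ∷_) (sublists xs)) W∈
... | inj₂ W∈xs = x ∷ʳ ∈-sublists⇒⊆ W∈xs
... | inj₁ W∈x∷ with _ , W′∈xs , refl ← ∈-map⁻ (x ∷_) W∈x∷ = refl ∷ ∈-sublists⇒⊆ W′∈xs

filter∈sublists : {P : X → Set} (P? : ∀ x → Dec (P x)) (xs : List X) → filter P? xs ∈ sublists xs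
filter∈sublists P? [] = here refl
filter∈sublists P? (x ∷ xs) with does (P? x)
... | true = ∈-++⁺ˡ (∈-map⁺ (x ∷_) (filter∈sublists P? xs))
... | false = ∈-++⁺ʳ (map (x ∷_) (sublists xs)) (filter∈sublists P? xs)

module _ (g : X → ℕ) where

  maximum : List X → ℕ
  maximum = foldr (λ x r → g x ⊔ r) 0

  ≤-maximum : ∀ {x xs} → x ∈ xs → g x ≤ maximum xs
  ≤-maximum {xs = y ∷ xs} (here refl) = m≤m⊔n (g y) (maximum xs)
  ≤-maximum {xs = y ∷ xs} (there x∈xs) = ≤-trans (≤-maximum x∈xs) (m≤n⊔m (g y) (maximum xs))

  maximum-attained : ∀ xs → maximum xs ≡ 0 ⊎ ∃ λ x → x ∈ xs × g x ≡ maximum xs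
  maximum-attained [] = inj₁ refl
  maximum-attained (x ∷ xs) with ⊔-sel (g x) (maximum xs)
  ... | inj₁ g≡ = inj₂ (x , here refl , sym g≡)
  ... | inj₂ max≡ with maximum-attained xs
  ...   | inj₁ ≡0 = inj₁ (trans max≡ ≡0)
  ...   | inj₂ (y , y∈xs , g≡) = inj₂ (y , there y∈xs , trans g≡ (sym max≡))

length≤count+length-filter : {P Q : X → Set} (P? : ∀ x → Dec (P x)) (Q? : ∀ x → Dec (Q x)) →
  {xs : List X} → All (λ x → P x ⊎ Q x) xs → length xs ≤ count (λ x → does (P? x)) xs + length (filter Q? xs)
length≤count+length-filter P? Q? [] = z≤n
length≤count+length-filter P? Q? {x ∷ xs} (px⊎qx ∷ rest) with P? x | Q? x
... | yes _ | yes _ = s≤s (≤-trans (length≤count+length-filter P? Q? rest) (+-monoʳ-≤ _ (n≤1+n _)))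
... | yes _ | no _ = s≤s (length≤count+length-filter P? Q? rest)
... | no _ | yes _ =
  subst (suc (length xs) ≤_) (sym (+-suc _ _)) (s≤s (length≤count+length-filter P? Q? rest))
... | no ¬px | no ¬qx = ⊥-elim (Sum.[ ¬px , ¬qx ] px⊎qx)

-- Orderings that put a given set of elements early

module PrefixCounting {X : Set} (_≟_ : DecidableEquality X) where

  open import Data.List.Membership.DecPropositional _≟_ using (_∈?_)

  allIn : List X → List X → Bool
  allIn T p = does (All.all? (_∈? p) T)

  inPrefix : ℕ → List X → List X → Bool
  inPrefix k T s = allIn T (take k s)

  countInPrefix : ℕ → List X → List X → ℕ
  countInPrefix k M s = count (λ e → does (e ∈? take k s)) M

  private
    take-insertAt-⇔ : ∀ {x : X} k i s T → x ∉ T → i < k → i ≤ length s →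
      All (_∈ take k (insertAt i x s)) T ⇔ All (_∈ take (pred k) s) T
    take-insertAt-⇔ k i s T x∉T i<k i≤s = mk⇔
      (λ T⊆ → All.tabulate λ e∈T → Sum.[ (λ { refl → ⊥-elim (x∉T e∈T) }) , id ]
                (∈-take-insertAt⁻ k i s i<k i≤s (All.lookup T⊆ e∈T)))
      (All.map (λ e∈ → ∈-take-insertAt⁺ k i s i<k i≤s (inj₂ e∈)))

  inPrefix-insertAt-< : ∀ {x : X} k i s T → x ∉ T → i < k → i ≤ length s →
    inPrefix k T (insertAt i x s) ≡ inPrefix (pred k) T s
  inPrefix-insertAt-< {x} k i s T x∉T i<k i≤s = does-⇔ (take-insertAt-⇔ k i s T x∉T i<k i≤s)
    (All.all? (_∈? take k (insertAt i x s)) T) (All.all? (_∈? take (pred k) s) T)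

  inPrefix-insertAt-≥ : ∀ {x : X} k i s T → k ≤ i → i ≤ length s →
    inPrefix k T (insertAt i x s) ≡ inPrefix k T s
  inPrefix-insertAt-≥ k i s T k≤i i≤s = cong (allIn T) (take-insertAt-≥ k i s k≤i i≤s)

  inPrefix-∷-insertAt-< : ∀ {x : X} k i s T → x ∉ T → i < k → i ≤ length s →
    inPrefix k (x ∷ T) (insertAt i x s) ≡ inPrefix (pred k) T s
  inPrefix-∷-insertAt-< {x} k i s T x∉T i<k i≤s =
    does-⇔ (mk⇔ (λ { (_ ∷ T⊆) → to T⊆ }) (λ T⊆ → ∈-take-insertAt⁺ k i s i<k i≤s (inj₁ refl) ∷ from T⊆))
      (All.all? (_∈? take k (insertAt i x s)) (x ∷ T)) (All.all? (_∈? take (pred k) s) T)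
    where open Equivalence (take-insertAt-⇔ k i s T x∉T i<k i≤s)

  inPrefix-∷-insertAt-≥ : ∀ {x : X} k i s T → x ∉ s → k ≤ i → i ≤ length s →
    inPrefix k (x ∷ T) (insertAt i x s) ≡ false
  inPrefix-∷-insertAt-≥ {x} k i s T x∉s k≤i i≤s =
    trans (cong (allIn (x ∷ T)) (take-insertAt-≥ k i s k≤i i≤s))
      (dec-false (All.all? (_∈? take k s) (x ∷ T)) λ { (x∈ ∷ _) → x∉s (Any-resp-⊆ (take-⊆ k s) x∈) })

  -- Induction on the first element y of ys: each ordering of y ∷ ys is an ordering of ys with y
  -- inserted at position i, and T stays early exactly when i < k and T ∖ y lies among the first
  -- k − 1 entries, or y ∉ T, i ≥ k and T lies among the first k entries.
  count-inPrefix≤ : ∀ {T ys : List X} → T ⊆ ys → Unique ys → ∀ k → k ≤ length ys →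
    count (inPrefix k T) (permutations ys) ≤ (k P′ length T) * (length ys ∸ length T) !
  count-inPrefix≤ [] _ zero _ = ≤-refl
  count-inPrefix≤ {T} {y ∷ ys} (.y ∷ʳ T⊆ys) uy∷ys@(_ ∷ uys) k k≤1+j = begin
    count (inPrefix k T) (permutations (y ∷ ys))
      ≡⟨ count-permutations-∷-two-valued {x = y} {ys} (inPrefix k T) (inPrefix (pred k) T) (inPrefix k T)
           k≤1+j (λ _ i<k i≤s → inPrefix-insertAt-< k _ _ T y∉T i<k i≤s)
           (λ _ k≤i i≤s → inPrefix-insertAt-≥ k _ _ T k≤i i≤s) ⟩
    k * count (inPrefix (pred k) T) (permutations ys) + (suc j ∸ k) * count (inPrefix k T) (permutations ys)
      ≤⟨ +-mono-≤ (*-monoʳ-≤ k (count-inPrefix≤ T⊆ys uys (pred k) (pred-mono-≤ k≤1+j))) late-insertions ⟩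
    k * ((pred k P′ t) * F) + (suc j ∸ k) * ((k P′ t) * F)
      ≡⟨ cong (_+ (suc j ∸ k) * ((k P′ t) * F)) (sym (*-assoc k (pred k P′ t) F)) ⟩
    k * (pred k P′ t) * F + (suc j ∸ k) * ((k P′ t) * F)
      ≡⟨ P′-insertion-identity k t j (length-mono-≤ T⊆ys) k≤1+j ⟩
    (k P′ t) * (suc j ∸ t) ! ∎
    where
    open ≤-Reasoning
    j = length ys
    t = length T
    F = (j ∸ t) !
    y∉T : y ∉ T
    y∉T y∈T = Unique[x∷xs]⇒x∉xs uy∷ys (Any-resp-⊆ T⊆ys y∈T)
    late-insertions : (suc j ∸ k) * count (inPrefix k T) (permutations ys) ≤ (suc j ∸ k) * ((k P′ t) * F)
    late-insertions with k ≤? j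
    ... | yes k≤j = *-monoʳ-≤ (suc j ∸ k) (count-inPrefix≤ T⊆ys uys k k≤j)
    ... | no k≰j rewrite ≤-antisym k≤1+j (≰⇒> k≰j) | n∸n≡0 (suc j) = z≤n
  count-inPrefix≤ {y ∷ T} {y ∷ ys} (refl ∷ T⊆ys) uy∷ys@(_ ∷ uys) k k≤1+j = begin
    count (inPrefix k (y ∷ T)) (permutations (y ∷ ys))
      ≡⟨ count-permutations-∷-two-valued {x = y} {ys} (inPrefix k (y ∷ T)) (inPrefix (pred k) T) (λ _ → false)
           k≤1+j (λ _ i<k i≤s → inPrefix-∷-insertAt-< k _ _ T y∉T i<k i≤s)
           (λ s↭ys k≤i i≤s → inPrefix-∷-insertAt-≥ k _ _ T (λ y∈s → y∉ys (∈-resp-↭ s↭ys y∈s)) k≤i i≤s) ⟩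
    k * early + (suc j ∸ k) * count (λ _ → false) (permutations ys)
      ≡⟨ cong (λ c → k * early + (suc j ∸ k) * c) (count-false (permutations ys)) ⟩
    k * early + (suc j ∸ k) * 0
      ≡⟨ trans (cong (k * early +_) (*-zeroʳ (suc j ∸ k))) (+-identityʳ _) ⟩
    k * early
      ≤⟨ *-monoʳ-≤ k (count-inPrefix≤ T⊆ys uys (pred k) (pred-mono-≤ k≤1+j)) ⟩
    k * ((pred k P′ t) * (j ∸ t) !)
      ≡⟨ *-assoc k (pred k P′ t) _ ⟨
    k * (pred k P′ t) * (j ∸ t) !
      ≡⟨ cong (_* (j ∸ t) !) (nP′[1+k]≡n*[n∸1]P′k k t) ⟨
    (k P′ suc t) * (j ∸ t) ! ∎
    where
    open ≤-Reasoning
    j = length ys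
    t = length T
    early = count (inPrefix (pred k) T) (permutations ys)
    y∉ys : y ∉ ys
    y∉ys = Unique[x∷xs]⇒x∉xs uy∷ys
    y∉T : y ∉ T
    y∉T y∈T = y∉ys (Any-resp-⊆ T⊆ys y∈T)

  ∑-C-countInPrefix≤ : ∀ {L M : List X} → Unique L → M ⊆ L → ∀ k t → k ≤ length L →
    ∑ (λ s → countInPrefix k M s C t) (permutations L) ≤ (length M C t) * ((k P′ t) * (length L ∸ t) !)
  ∑-C-countInPrefix≤ {L} {M} uL M⊆L k t k≤L = begin
    ∑ (λ s → countInPrefix k M s C t) (permutations L)
      ≡⟨ ∑-cong (permutations-↭ L) (λ {s} _ → trans (sym (count-all-combinations (_∈? take k s) t M))
                                                    (count≡∑ind (λ T → inPrefix k T s) (combinations t M))) ⟩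
    ∑ (λ s → ∑ (λ T → ind (inPrefix k T s)) (combinations t M)) (permutations L)
      ≡⟨ ∑-comm (λ s T → ind (inPrefix k T s)) (permutations L) (combinations t M) ⟩
    ∑ (λ T → ∑ (λ s → ind (inPrefix k T s)) (permutations L)) (combinations t M)
      ≤⟨ ∑-mono-≤ (combinations-⊆ t M) (λ {T} (T⊆M , ∣T∣≡t) → subst (λ u → _ ≤ (k P′ u) * (length L ∸ u) !) ∣T∣≡t
           (subst (_≤ _) (count≡∑ind (inPrefix k T) (permutations L)) (count-inPrefix≤ (⊆-trans T⊆M M⊆L) uL k k≤L))) ⟩
    ∑ (λ _ → (k P′ t) * (length L ∸ t) !) (combinations t M)
      ≡⟨ ∑-const _ (combinations t M) ⟩
    length (combinations t M) * ((k P′ t) * (length L ∸ t) !)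
      ≡⟨ cong (_* ((k P′ t) * (length L ∸ t) !)) (length-combinations t M) ⟩
    (length M C t) * ((k P′ t) * (length L ∸ t) !) ∎
    where open ≤-Reasoning

-- Matchings

module _ {n : ℕ} where

  Disjoint : Edge n → Edge n → Set
  Disjoint e f = T (disjointᵇ e f)

  private
    ≢ᵇ-sym : ∀ (u v : Fin n) → not ⌊ u Fin.≟ v ⌋ ≡ not ⌊ v Fin.≟ u ⌋
    ≢ᵇ-sym u v = cong not (trans (isYes≗does (u Fin.≟ v))
      (trans (does-⇔ (mk⇔ sym sym) (u Fin.≟ v) (v Fin.≟ u)) (sym (isYes≗does (v Fin.≟ u)))))

    ∧-swap-middle : ∀ p q r s → p ∧ q ∧ r ∧ s ≡ p ∧ r ∧ q ∧ s
    ∧-swap-middle false _ _ _ = refl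
    ∧-swap-middle true false false _ = refl
    ∧-swap-middle true false true _ = refl
    ∧-swap-middle true true false _ = refl
    ∧-swap-middle true true true _ = refl

  -- disjointᵇ (c , d) (a , b) performs the four tests of disjointᵇ (a , b) (c , d) with the
  -- middle two swapped.
  Disjoint-sym : ∀ {e f} → Disjoint e f → Disjoint f e
  Disjoint-sym {a , b} {c , d} rewrite ≢ᵇ-sym a c | ≢ᵇ-sym a d | ≢ᵇ-sym b c | ≢ᵇ-sym b d =
    subst T (∧-swap-middle (not ⌊ c Fin.≟ a ⌋) (not ⌊ d Fin.≟ a ⌋)
                           (not ⌊ c Fin.≟ b ⌋) (not ⌊ d Fin.≟ b ⌋))

  private
    T-foldr-∧⇔All : ∀ e es → T (foldr (λ f r → disjointᵇ e f ∧ r) true es) ⇔ All (Disjoint e) es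
    T-foldr-∧⇔All e [] = mk⇔ (λ _ → []) (λ _ → _)
    T-foldr-∧⇔All e (f ∷ es) = mk⇔
      (λ h → let (ef , rest) = Equivalence.to T-∧ h in ef ∷ Equivalence.to (T-foldr-∧⇔All e es) rest)
      (λ { (ef ∷ rest) → Equivalence.from T-∧ (ef , Equivalence.from (T-foldr-∧⇔All e es) rest) })

  isMatchingᵇ⇔AllPairs : ∀ M → T (isMatchingᵇ M) ⇔ AllPairs Disjoint M
  isMatchingᵇ⇔AllPairs [] = mk⇔ (λ _ → []) (λ _ → _)
  isMatchingᵇ⇔AllPairs (e ∷ es) = mk⇔
    (λ h → let (he , hes) = Equivalence.to T-∧ h
           in Equivalence.to (T-foldr-∧⇔All e es) he ∷ Equivalence.to (isMatchingᵇ⇔AllPairs es) hes)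
    (λ { (he ∷ hes) → Equivalence.from T-∧
           (Equivalence.from (T-foldr-∧⇔All e es) he , Equivalence.from (isMatchingᵇ⇔AllPairs es) hes) })

  AllPairs-Disjoint-members : ∀ {W M : List (Edge n)} → Unique W → All (_∈ M) W → AllPairs Disjoint M →
    AllPairs Disjoint W
  AllPairs-Disjoint-members [] [] _ = []
  AllPairs-Disjoint-members (w≢W ∷ uW) (w∈M ∷ W⊆M) dM =
    All.zipWith (λ (w≢e , e∈M) → lookup-Disjoint dM w∈M e∈M w≢e) (w≢W , W⊆M)
      ∷ AllPairs-Disjoint-members uW W⊆M dM
    where
    lookup-Disjoint : ∀ {M e f} → AllPairs Disjoint M → e ∈ M → f ∈ M → e ≢ f → Disjoint e f
    lookup-Disjoint (_ ∷ _) (here refl) (here refl) e≢f = ⊥-elim (e≢f refl)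
    lookup-Disjoint (de ∷ _) (here refl) (there f∈) _ = All.lookup de f∈
    lookup-Disjoint {x ∷ _} {e} (de ∷ _) (there e∈) (here refl) _ = Disjoint-sym {x} {e} (All.lookup de e∈)
    lookup-Disjoint (_ ∷ dM) (there e∈) (there f∈) e≢f = lookup-Disjoint dM e∈ f∈ e≢f

  matchingSize : List (Edge n) → ℕ
  matchingSize s = if isMatchingᵇ s then length s else 0

  matching≤μ : ∀ {W L : List (Edge n)} → W ∈ sublists L → T (isMatchingᵇ W) → length W ≤ μ L
  matching≤μ {W} {L} W∈ mW with isMatchingᵇ W | ≤-maximum matchingSize W∈
  ... | true | le = le

  maximumMatching : ∀ L → ∃ λ M → M ⊆ L × T (isMatchingᵇ M) × length M ≡ μ L
  maximumMatching L with maximum-attained matchingSize (sublists L)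
  ... | inj₁ μ≡0 = [] , minimum L , _ , sym μ≡0
  ... | inj₂ (W , W∈ , size≡) with isMatchingᵇ W in mW
  ...   | true = W , ∈-sublists⇒⊆ W∈ , subst T (sym mW) _ , size≡
  ...   | false = [] , minimum L , _ , size≡

  _≟ᴱ_ : DecidableEquality (Edge n)
  _≟ᴱ_ = ≡-dec Fin._≟_ Fin._≟_

  open PrefixCounting _≟ᴱ_
  open import Data.List.Membership.DecPropositional _≟ᴱ_ using (_∈?_)

  length≤countInPrefix+μ[drop] : ∀ {L M s : List (Edge n)} → Unique L → M ⊆ L → T (isMatchingᵇ M) →
    s ↭ L → ∀ k → length M ≤ countInPrefix k M s + μ (drop k s)
  length≤countInPrefix+μ[drop] {L} {M} {s} uL M⊆L mM s↭L k = begin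
    length M                       ≤⟨ length≤count+length-filter (_∈? take k s) (_∈? D) M-split ⟩
    countInPrefix k M s + length F ≤⟨ +-monoʳ-≤ (countInPrefix k M s) (≤-trans ∣F∣≤∣W∣ ∣W∣≤μD) ⟩
    countInPrefix k M s + μ D      ∎
    where
    open ≤-Reasoning
    D = drop k s
    F = filter (_∈? D) M
    W = filter (_∈? M) D
    M-split : All (λ e → e ∈ take k s ⊎ e ∈ D) M
    M-split = All.tabulate λ e∈M → ∈-++⁻ (take k s)
      (subst (_ ∈_) (sym (take++drop≡id k s)) (∈-resp-↭ (↭-sym s↭L) (Any-resp-⊆ M⊆L e∈M)))
    uW : Unique W
    uW = Unique.filter⁺ (_∈? M) (Unique.drop⁺ k (Unique-resp-↭ (↭-sym s↭L) uL))
    ∣F∣≤∣W∣ : length F ≤ length W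
    ∣F∣≤∣W∣ = Unique⇒length≤ _≟ᴱ_ (Unique.filter⁺ (_∈? D) (AllPairs-resp-⊆ M⊆L uL))
      (All.tabulate λ e∈F → let (e∈M , e∈D) = ∈-filter⁻ (_∈? D) e∈F
                            in ∈-filter⁺ (_∈? M) e∈D e∈M)
    W-matching : T (isMatchingᵇ W)
    W-matching = Equivalence.from (isMatchingᵇ⇔AllPairs W)
      (AllPairs-Disjoint-members uW (All.tabulate λ e∈W → proj₂ (∈-filter⁻ (_∈? M) {xs = D} e∈W))
        (Equivalence.to (isMatchingᵇ⇔AllPairs M) mM))
    ∣W∣≤μD : length W ≤ μ D
    ∣W∣≤μD = matching≤μ {L = D} (filter∈sublists (_∈? M) D) W-matching

-- Arithmetic estimates

P′-product-ratio : ∀ t {p q a b c e} →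
  (∀ {i} → i < t → p * ((a ∸ i) * (b ∸ i)) ≤ q * ((c ∸ i) * (e ∸ i))) →
  p ^ t * ((a P′ t) * (b P′ t)) ≤ q ^ t * ((c P′ t) * (e P′ t))
P′-product-ratio zero _ = ≤-refl
P′-product-ratio (suc t) {p} {q} {a} {b} {c} {e} factor≤ = begin
  p * p ^ t * ((a ∸ t) * (a P′ t) * ((b ∸ t) * (b P′ t)))
    ≡⟨ regroup p (p ^ t) (a ∸ t) (a P′ t) (b ∸ t) (b P′ t) ⟩
  p * ((a ∸ t) * (b ∸ t)) * (p ^ t * ((a P′ t) * (b P′ t)))
    ≤⟨ *-mono-≤ (factor≤ (n<1+n t)) (P′-product-ratio t (λ i<t → factor≤ (m<n⇒m<1+n i<t))) ⟩
  q * ((c ∸ t) * (e ∸ t)) * (q ^ t * ((c P′ t) * (e P′ t)))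
    ≡⟨ regroup q (q ^ t) (c ∸ t) (c P′ t) (e ∸ t) (e P′ t) ⟨
  q * q ^ t * ((c ∸ t) * (c P′ t) * ((e ∸ t) * (e P′ t))) ∎
  where
  open ≤-Reasoning
  regroup : ∀ p P a A b B → p * P * (a * A * (b * B)) ≡ p * (a * b) * (P * (A * B))
  regroup = solve-∀

ratio-∸-≤ : ∀ {P Q k m} i → k * Q ≤ P * m → k ≤ m → (k ∸ i) * Q ≤ P * (m ∸ i)
ratio-∸-≤ {P} {Q} {k} {m} i kQ≤Pm k≤m with k ≤? i
... | yes k≤i rewrite m≤n⇒m∸n≡0 k≤i = z≤n
... | no k≰i = *-cancelʳ-≤ ((k ∸ i) * Q) (P * c) m {{>-nonZero (<-≤-trans (≤-<-trans z≤n i<k) k≤m)}} (begin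
  (k ∸ i) * Q * m               ≡⟨ cong ((k ∸ i) * Q *_) (sym i+c≡m) ⟩
  b * Q * (i + c)               ≡⟨ expand-left b Q i c ⟩
  Q * b * i + Q * b * c         ≤⟨ +-monoˡ-≤ (Q * b * c) (*-monoˡ-≤ i (*-monoʳ-≤ Q b≤c)) ⟩
  Q * c * i + Q * b * c         ≡⟨ expand-right b Q i c ⟩
  (i + b) * Q * c               ≡⟨ cong (λ z → z * Q * c) i+b≡k ⟩
  k * Q * c                     ≤⟨ *-monoˡ-≤ c kQ≤Pm ⟩
  P * m * c                     ≡⟨ cong (λ z → P * z * c) (sym i+c≡m) ⟩
  P * (i + c) * c               ≡⟨ swap-last P (i + c) c ⟩
  P * c * (i + c)               ≡⟨ cong (P * c *_) i+c≡m ⟩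
  P * c * m                     ∎)
  where
  open ≤-Reasoning
  b = k ∸ i
  c = m ∸ i
  i<k = ≰⇒> k≰i
  i+b≡k : i + b ≡ k
  i+b≡k = m+[n∸m]≡n (<⇒≤ i<k)
  i+c≡m : i + c ≡ m
  i+c≡m = m+[n∸m]≡n (≤-trans (<⇒≤ i<k) k≤m)
  b≤c : b ≤ c
  b≤c = ∸-monoˡ-≤ i k≤m
  expand-left : ∀ b Q i c → b * Q * (i + c) ≡ Q * b * i + Q * b * c
  expand-left = solve-∀
  expand-right : ∀ b Q i c → Q * c * i + Q * b * c ≡ (i + b) * Q * c
  expand-right = solve-∀
  swap-last : ∀ P x c → P * x * c ≡ P * c * x
  swap-last = solve-∀

three-quarters-bound : ∀ {P Q μ r i} → 2 * P * μ < r * Q → 4 * i ≤ r → 3 * P * μ ≤ 2 * Q * (r ∸ i)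
three-quarters-bound {P} {Q} {μ} {r} {i} 2Pμ<rQ 4i≤r = *-cancelˡ-≤ 2 (<⇒≤ (begin-strict
  2 * (3 * P * μ)                 ≡⟨ rearrange P μ ⟩
  3 * (2 * P * μ)                 <⟨ *-monoʳ-< 3 2Pμ<rQ ⟩
  3 * (r * Q)                     ≡⟨ cong (λ z → 3 * (z * Q)) (sym i+e≡r) ⟩
  3 * ((i + e) * Q)               ≡⟨ expand i e Q ⟩
  (3 * i + 3 * e) * Q             ≤⟨ *-monoˡ-≤ Q (+-monoˡ-≤ (3 * e) 3i≤e) ⟩
  (e + 3 * e) * Q                 ≡⟨ collect e Q ⟩
  2 * (2 * Q * e)                 ∎))
  where
  open ≤-Reasoning
  e = r ∸ i
  i+e≡r : i + e ≡ r
  i+e≡r = m+[n∸m]≡n (≤-trans (m≤n*m i 4) 4i≤r)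
  3i≤e : 3 * i ≤ e
  3i≤e = +-cancelˡ-≤ i (3 * i) e (subst₂ _≤_ (split-four i) (sym i+e≡r) 4i≤r)
    where
    split-four : ∀ i → 4 * i ≡ i + 3 * i
    split-four = solve-∀
  rearrange : ∀ P μ → 2 * (3 * P * μ) ≡ 3 * (2 * P * μ)
  rearrange = solve-∀
  expand : ∀ i e Q → 3 * ((i + e) * Q) ≡ (3 * i + 3 * e) * Q
  expand = solve-∀
  collect : ∀ e Q → (e + 3 * e) * Q ≡ 2 * (2 * Q * e)
  collect = solve-∀

early-prefix-factor-bound : ∀ {P Q μ k m r i} → 0 < Q → k * Q ≤ P * m → k ≤ m →
  2 * P * μ < r * Q → 4 * i ≤ r → 3 * ((μ ∸ i) * (k ∸ i)) ≤ 2 * ((r ∸ i) * (m ∸ i))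
early-prefix-factor-bound {P} {Q} {μ} {k} {m} {r} {i} Q>0 kQ≤Pm k≤m 2Pμ<rQ 4i≤r =
  *-cancelˡ-≤ Q {{>-nonZero Q>0}} (begin
    Q * (3 * ((μ ∸ i) * (k ∸ i)))   ≡⟨ regroup Q (μ ∸ i) (k ∸ i) ⟩
    3 * (μ ∸ i) * ((k ∸ i) * Q)     ≤⟨ *-mono-≤ (*-monoʳ-≤ 3 (m∸n≤m μ i)) (ratio-∸-≤ {P} {Q} i kQ≤Pm k≤m) ⟩
    3 * μ * (P * (m ∸ i))           ≡⟨ regroup′ μ P (m ∸ i) ⟩
    3 * P * μ * (m ∸ i)             ≤⟨ *-monoˡ-≤ (m ∸ i) (three-quarters-bound {P} {Q} {μ} {r} {i} 2Pμ<rQ 4i≤r) ⟩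
    2 * Q * (r ∸ i) * (m ∸ i)       ≡⟨ regroup″ Q (r ∸ i) (m ∸ i) ⟩
    Q * (2 * ((r ∸ i) * (m ∸ i)))   ∎)
  where
  open ≤-Reasoning
  regroup : ∀ Q a b → Q * (3 * (a * b)) ≡ 3 * a * (b * Q)
  regroup = solve-∀
  regroup′ : ∀ μ P c → 3 * μ * (P * c) ≡ 3 * P * μ * c
  regroup′ = solve-∀
  regroup″ : ∀ Q e c → 2 * Q * e * c ≡ Q * (2 * (e * c))
  regroup″ = solve-∀

[m*n]^o≡m^o*n^o : ∀ m n o → (m * n) ^ o ≡ m ^ o * n ^ o
[m*n]^o≡m^o*n^o m n zero = refl
[m*n]^o≡m^o*n^o m n (suc o) rewrite [m*n]^o≡m^o*n^o m n o = interchange m n (m ^ o) (n ^ o)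
  where open import Algebra.Properties.CommutativeSemigroup *-commutativeSemigroup using (interchange)

[m^n]^o≡[m^o]^n : ∀ m n o → (m ^ n) ^ o ≡ (m ^ o) ^ n
[m^n]^o≡[m^o]^n m n o = trans (^-*-assoc m n o) (trans (cong (m ^_) (*-comm n o)) (sym (^-*-assoc m o n)))

^-cancelˡ-≤ : ∀ o .{{_ : NonZero o}} {m n} → m ^ o ≤ n ^ o → m ≤ n
^-cancelˡ-≤ o {m} {n} mᵒ≤nᵒ with m ≤? n
... | yes m≤n = m≤n
... | no m≰n = ⊥-elim (<⇒≱ (^-monoˡ-< o (≰⇒> m≰n)) mᵒ≤nᵒ)

2*64^t≤81^t : ∀ t → 3 ≤ t → 2 * 64 ^ t ≤ 81 ^ t
2*64^t≤81^t t 3≤t = subst (λ u → 2 * 64 ^ u ≤ 81 ^ u) (m+[n∸m]≡n 3≤t) (from-three (t ∸ 3))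
  where
  from-three : ∀ s → 2 * 64 ^ (3 + s) ≤ 81 ^ (3 + s)
  from-three zero = ≤ᵇ⇒≤ (2 * 64 ^ 3) (81 ^ 3) _
  from-three (suc s) = begin
    2 * (64 * 64 ^ (3 + s))   ≡⟨ x∙yz≈y∙xz 2 64 (64 ^ (3 + s)) ⟩
    64 * (2 * 64 ^ (3 + s))   ≤⟨ *-mono-≤ (≤ᵇ⇒≤ 64 81 _) (from-three s) ⟩
    81 * 81 ^ (3 + s)         ∎
    where
    open ≤-Reasoning
    open import Algebra.Properties.CommutativeSemigroup *-commutativeSemigroup using (x∙yz≈y∙xz)

n⁵2ᵗ≤3ᵗ : ∀ {n t} → 2 ≤ n → n ^ 20 ≤ 2 * 4 ^ t → n ^ 5 * 2 ^ t ≤ 3 ^ t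
n⁵2ᵗ≤3ᵗ {n} {t} 2≤n n²⁰≤2*4ᵗ = ^-cancelˡ-≤ 4 (begin
  (n ^ 5 * 2 ^ t) ^ 4      ≡⟨ [m*n]^o≡m^o*n^o (n ^ 5) (2 ^ t) 4 ⟩
  (n ^ 5) ^ 4 * (2 ^ t) ^ 4 ≡⟨ cong₂ _*_ (^-*-assoc n 5 4) ([m^n]^o≡[m^o]^n 2 t 4) ⟩
  n ^ 20 * 16 ^ t          ≤⟨ *-monoˡ-≤ (16 ^ t) n²⁰≤2*4ᵗ ⟩
  2 * 4 ^ t * 16 ^ t       ≡⟨ *-assoc 2 (4 ^ t) (16 ^ t) ⟩
  2 * (4 ^ t * 16 ^ t)     ≡⟨ cong (2 *_) ([m*n]^o≡m^o*n^o 4 16 t) ⟨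
  2 * 64 ^ t               ≤⟨ 2*64^t≤81^t t 3≤t ⟩
  81 ^ t                   ≡⟨ sym ([m^n]^o≡[m^o]^n 3 t 4) ⟩
  (3 ^ t) ^ 4              ∎)
  where
  open ≤-Reasoning
  3≤t : 3 ≤ t
  3≤t with 3 ≤? t
  ... | yes 3≤t = 3≤t
  ... | no 3≰t = ⊥-elim (<⇒≱ 2*4ᵗ<2²⁰ (≤-trans (^-monoˡ-≤ 20 2≤n) n²⁰≤2*4ᵗ))
    where
    2*4ᵗ<2²⁰ : 2 * 4 ^ t < 2 ^ 20
    2*4ᵗ<2²⁰ = ≤-<-trans (*-monoʳ-≤ 2 (^-monoʳ-≤ 4 (≤-pred (≰⇒> 3≰t)))) (≤ᵇ⇒≤ 33 (2 ^ 20) _)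

falling-factorial-bound : ∀ {n P Q μ k m r t} → 2 ≤ n → 0 < Q → k * Q ≤ P * m → k ≤ m →
  2 * P * μ < r * Q → 4 * pred t ≤ r → n ^ 20 ≤ 2 * 4 ^ t →
  n ^ 5 * ((μ P′ t) * (k P′ t)) ≤ (r P′ t) * (m P′ t)
falling-factorial-bound {n} {P} {Q} {μ} {k} {m} {r} {t} 2≤n Q>0 kQ≤Pm k≤m 2Pμ<rQ 4[t∸1]≤r n²⁰≤2*4ᵗ =
  *-cancelˡ-≤ (2 ^ t) {{m^n≢0 2 t}} (begin
    2 ^ t * (n ^ 5 * A)       ≡⟨ x∙yz≈y∙xz (2 ^ t) (n ^ 5) A ⟩
    n ^ 5 * (2 ^ t * A)       ≡⟨ *-assoc (n ^ 5) (2 ^ t) A ⟨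
    n ^ 5 * 2 ^ t * A         ≤⟨ *-monoˡ-≤ A (n⁵2ᵗ≤3ᵗ {n} {t} 2≤n n²⁰≤2*4ᵗ) ⟩
    3 ^ t * A                 ≤⟨ P′-product-ratio t factor≤ ⟩
    2 ^ t * ((r P′ t) * (m P′ t)) ∎)
  where
  open ≤-Reasoning
  open import Algebra.Properties.CommutativeSemigroup *-commutativeSemigroup using (x∙yz≈y∙xz)
  A = (μ P′ t) * (k P′ t)
  factor≤ : ∀ {i} → i < t → 3 * ((μ ∸ i) * (k ∸ i)) ≤ 2 * ((r ∸ i) * (m ∸ i))
  factor≤ {i} i<t = early-prefix-factor-bound {P} {Q} {μ} {k} {m} {r} {i} Q>0 kQ≤Pm k≤m 2Pμ<rQ
    (≤-trans (*-monoʳ-≤ 4 (pred-mono-≤ i<t)) 4[t∸1]≤r)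

complement-bound : ∀ {N good bad all} → good + bad ≡ all → N * bad ≤ all → (N ∸ 1) * all ≤ N * good
complement-bound {N} {good} {bad} {all} good+bad≡all Nbad≤all = begin
  (N ∸ 1) * all              ≡⟨ *-distribʳ-∸ all N 1 ⟩
  N * all ∸ 1 * all          ≡⟨ cong (N * all ∸_) (*-identityˡ all) ⟩
  N * all ∸ all              ≤⟨ ∸-monoʳ-≤ (N * all) Nbad≤all ⟩
  N * all ∸ N * bad          ≡⟨ cong (λ z → N * z ∸ N * bad) (sym good+bad≡all) ⟩
  N * (good + bad) ∸ N * bad ≡⟨ cong (_∸ N * bad) (*-distribˡ-+ N good bad) ⟩
  N * good + N * bad ∸ N * bad ≡⟨ m+n∸n≡m (N * good) (N * bad) ⟩
  N * good                   ∎
  where open ≤-Reasoning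

m<[1+m/n]*n : ∀ m n .{{_ : NonZero n}} → m < suc (m / n) * n
m<[1+m/n]*n m n = begin-strict
  m                   ≡⟨ m≡m%n+[m/n]*n m n ⟩
  m % n + (m / n) * n <⟨ +-monoˡ-< ((m / n) * n) (m%n<n m n) ⟩
  n + (m / n) * n     ∎
  where open ≤-Reasoning

μP²≤tQ² : ∀ {P Q μ r t} → 2 * P < Q → 2 * P * μ < r * Q → r ≤ 4 * t → μ * P * P ≤ t * Q * Q
μP²≤tQ² {P} {Q} {μ} {r} {t} 2P<Q 2Pμ<rQ r≤4t = *-cancelˡ-≤ 2 (begin
  2 * (μ * P * P)          ≡⟨ regroup μ P ⟩
  P * (2 * P * μ)          ≤⟨ *-monoʳ-≤ P (<⇒≤ 2Pμ<rQ) ⟩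
  P * (r * Q)              ≤⟨ *-monoʳ-≤ P (*-monoˡ-≤ Q r≤4t) ⟩
  P * (4 * t * Q)          ≡⟨ regroup′ P t Q ⟩
  2 * P * (2 * t * Q)      ≤⟨ *-monoˡ-≤ (2 * t * Q) (<⇒≤ 2P<Q) ⟩
  Q * (2 * t * Q)          ≡⟨ regroup″ Q t ⟩
  2 * (t * Q * Q)          ∎)
  where
  open ≤-Reasoning
  regroup : ∀ μ P → 2 * (μ * P * P) ≡ P * (2 * P * μ)
  regroup = solve-∀
  regroup′ : ∀ P t Q → P * (4 * t * Q) ≡ 2 * P * (2 * t * Q)
  regroup′ = solve-∀
  regroup″ : ∀ Q t → Q * (2 * t * Q) ≡ 2 * (t * Q * Q)
  regroup″ = solve-∀

-- Unnormalised rationals a / (1 + d) with an explicit denominator: their arithmetic is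
-- syntactic, so comparisons reduce to inequalities between natural numbers.

infix 8 _/1+_

_/1+_ : ℕ → ℕ → ℚᵘ
a /1+ d = mkℚᵘ (ℤ.+ a) d

toℚᵘ-ℕ→ℚ : ∀ a → ℚ.toℚᵘ (ℕ→ℚ a) ℚᵘ.≃ a /1+ 0
toℚᵘ-ℕ→ℚ a = ℚ.toℚᵘ-fromℚᵘ (a /1+ 0)

toℚᵘ-/ : ∀ a d → ℚ.toℚᵘ (ℤ.+ a ℚ./ suc d) ℚᵘ.≃ a /1+ d
toℚᵘ-/ a d = ℚ.toℚᵘ-fromℚᵘ (a /1+ d)

/1+-* : ∀ a d b e → a /1+ d ℚᵘ.* b /1+ e ≡ (a * b) /1+ (e + d * suc e)
/1+-* a d b e = cong (λ z → mkℚᵘ z (e + d * suc e)) (sym (ℤ.pos-* a b))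

/1+-+ : ∀ a d b e → a /1+ d ℚᵘ.+ b /1+ e ≡ (a * suc e + b * suc d) /1+ (e + d * suc e)
/1+-+ a d b e = cong (λ z → mkℚᵘ z (e + d * suc e)) (begin
  ℤ.+ a ℤ.* ℤ.+ suc e ℤ.+ ℤ.+ b ℤ.* ℤ.+ suc d ≡⟨ cong₂ ℤ._+_ (ℤ.pos-* a (suc e)) (ℤ.pos-* b (suc d)) ⟨
  ℤ.+ (a * suc e) ℤ.+ ℤ.+ (b * suc d)         ≡⟨ ℤ.pos-+ (a * suc e) (b * suc d) ⟨
  ℤ.+ (a * suc e + b * suc d)                 ∎)
  where open ≡-Reasoning

/1+-mono-≤ : ∀ {a d b e} → a * suc e ≤ b * suc d → a /1+ d ℚᵘ.≤ b /1+ e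
/1+-mono-≤ {a} {d} {b} {e} le = *≤* (subst₂ ℤ._≤_ (ℤ.pos-* a (suc e)) (ℤ.pos-* b (suc d)) (+≤+ le))

/1+-cancel-≤ : ∀ {a d b e} → a /1+ d ℚᵘ.≤ b /1+ e → a * suc e ≤ b * suc d
/1+-cancel-≤ {a} {d} {b} {e} (*≤* le)
  with +≤+ le′ ← subst₂ ℤ._≤_ (sym (ℤ.pos-* a (suc e))) (sym (ℤ.pos-* b (suc d))) le = le′

/1+-cancel-< : ∀ {a d b e} → a /1+ d ℚᵘ.< b /1+ e → a * suc e < b * suc d
/1+-cancel-< {a} {d} {b} {e} (*<* lt)
  with +<+ lt′ ← subst₂ ℤ._<_ (sym (ℤ.pos-* a (suc e))) (sym (ℤ.pos-* b (suc d))) lt = lt′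

module _ {p q : ℚ} {u v : ℚᵘ} (p≃u : ℚ.toℚᵘ p ℚᵘ.≃ u) (q≃v : ℚ.toℚᵘ q ℚᵘ.≃ v) where

  ≤-fromℚᵘ : u ℚᵘ.≤ v → p ℚ.≤ q
  ≤-fromℚᵘ u≤v =
    ℚ.toℚᵘ-cancel-≤ (ℚᵘ.≤-respʳ-≃ (ℚᵘ.≃-sym q≃v) (ℚᵘ.≤-respˡ-≃ (ℚᵘ.≃-sym p≃u) u≤v))

  ≤-toℚᵘ : p ℚ.≤ q → u ℚᵘ.≤ v
  ≤-toℚᵘ p≤q = ℚᵘ.≤-respʳ-≃ q≃v (ℚᵘ.≤-respˡ-≃ p≃u (ℚ.toℚᵘ-mono-≤ p≤q))

  <-toℚᵘ : p ℚ.< q → u ℚᵘ.< v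
  <-toℚᵘ p<q = ℚᵘ.<-respʳ-≃ q≃v (ℚᵘ.<-respˡ-≃ p≃u (ℚ.toℚᵘ-mono-< p<q))

  toℚᵘ-* : ℚ.toℚᵘ (p ℚ.* q) ℚᵘ.≃ u ℚᵘ.* v
  toℚᵘ-* = ℚᵘ.≃-trans (ℚ.toℚᵘ-homo-* p q) (ℚᵘ.*-cong p≃u q≃v)

  toℚᵘ-+ : ℚ.toℚᵘ (p ℚ.+ q) ℚᵘ.≃ u ℚᵘ.+ v
  toℚᵘ-+ = ℚᵘ.≃-trans (ℚ.toℚᵘ-homo-+ p q) (ℚᵘ.+-cong p≃u q≃v)

  toℚᵘ-- : ℚ.toℚᵘ (p ℚ.- q) ℚᵘ.≃ u ℚᵘ.- v
  toℚᵘ-- = ℚᵘ.≃-trans (ℚ.toℚᵘ-homo-+ p (ℚ.- q))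
    (ℚᵘ.+-cong p≃u (ℚᵘ.≃-trans (ℚ.toℚᵘ-homo‿- q) (ℚᵘ.-‿cong q≃v)))

ℕ→ℚ-cancel-≤ : ∀ {a b} → ℕ→ℚ a ℚ.≤ ℕ→ℚ b → a ≤ b
ℕ→ℚ-cancel-≤ {a} {b} a≤b = subst₂ _≤_ (*-identityʳ a) (*-identityʳ b)
  (/1+-cancel-≤ (≤-toℚᵘ (toℚᵘ-ℕ→ℚ a) (toℚᵘ-ℕ→ℚ b) a≤b))

⌊⌋ℕ-≤ : ∀ w → 0ℚ ℚ.≤ w → ℕ→ℚ ⌊ w ⌋ℕ ℚ.≤ w
⌊⌋ℕ-≤ (mkℚ (ℤ.+ a) b _) _ rewrite cong ℤ.∣_∣ (ℤ.div-pos-is-/ℕ (ℤ.+ a) (suc b)) =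
  ≤-fromℚᵘ (toℚᵘ-ℕ→ℚ (a / suc b)) ℚᵘ.≃-refl
    (/1+-mono-≤ (≤-trans (m/n*n≤m a (suc b)) (≤-reflexive (sym (*-identityʳ a)))))
⌊⌋ℕ-≤ (mkℚ ℤ.-[1+ _ ] _ _) (ℚ.*≤* ())

fraction-below-half : ∀ {ε} → 0ℚ ℚ.< ε → ε ℚ.< ½ →
  ∃₂ λ P d → ℚ.toℚᵘ ε ℚᵘ.≃ P /1+ d × 2 * P < suc d
fraction-below-half {mkℚ (ℤ.+ P) d _} _ ε<½ = P , d , ℚᵘ.≃-refl ,
  subst₂ _<_ (*-comm P 2) (+-identityʳ (suc d)) (/1+-cancel-< (<-toℚᵘ ℚᵘ.≃-refl (toℚᵘ-/ 1 1) ε<½))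
fraction-below-half {mkℚ ℤ.-[1+ _ ] _ _} (ℚ.*<* ()) _

module FractionFacts {ε : ℚ} {P d : ℕ} (ε≃P/Q : ℚ.toℚᵘ ε ℚᵘ.≃ P /1+ d) where

  open import Data.Rational.Unnormalised.Solver using (module +-*-Solver)
  open +-*-Solver using (solve; _:+_; _:-_; _:*_; _:=_; con)

  ⌊εm⌋*Q≤P*m : ∀ m → ⌊ ε ℚ.* ℕ→ℚ m ⌋ℕ * suc d ≤ P * m
  ⌊εm⌋*Q≤P*m m = subst₂ _≤_ (cong (λ z → k * suc z) (*-identityʳ d)) (*-identityʳ (P * m))
    (/1+-cancel-≤ (≤-toℚᵘ (toℚᵘ-ℕ→ℚ k) εm≃ (⌊⌋ℕ-≤ (ε ℚ.* ℕ→ℚ m) εm≥0)))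
    where
    k = ⌊ ε ℚ.* ℕ→ℚ m ⌋ℕ
    εm≃ : ℚ.toℚᵘ (ε ℚ.* ℕ→ℚ m) ℚᵘ.≃ (P * m) /1+ (0 + d * 1)
    εm≃ = ℚᵘ.≃-trans (toℚᵘ-* ε≃P/Q (toℚᵘ-ℕ→ℚ m)) (ℚᵘ.≃-reflexive (/1+-* P d m 0))
    εm≥0 : 0ℚ ℚ.≤ ε ℚ.* ℕ→ℚ m
    εm≥0 = ≤-fromℚᵘ (toℚᵘ-ℕ→ℚ 0) εm≃ (/1+-mono-≤ z≤n)

  [1-2ε]μ≤ : ∀ {μ μ′ c} → μ ≤ μ′ + c → c * suc d ≤ 2 * P * μ →
    (1ℚ ℚ.- (ε ℚ.+ ε)) ℚ.* ℕ→ℚ μ ℚ.≤ ℕ→ℚ μ′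
  [1-2ε]μ≤ {μ} {μ′} {c} μ≤μ′+c cQ≤2Pμ =
    ≤-fromℚᵘ (toℚᵘ-* (toℚᵘ-- (toℚᵘ-ℕ→ℚ 1) (toℚᵘ-+ ε≃P/Q ε≃P/Q)) (toℚᵘ-ℕ→ℚ μ)) (toℚᵘ-ℕ→ℚ μ′) (begin
      (ℚᵘ.1ℚᵘ ℚᵘ.- (e ℚᵘ.+ e)) ℚᵘ.* M
        ≃⟨ solve 2 (λ e M → (con ℚᵘ.1ℚᵘ :- (e :+ e)) :* M := M :- (e :+ e) :* M) ℚᵘ.≃-refl e M ⟩
      M ℚᵘ.- E
        ≤⟨ ℚᵘ.+-monoˡ-≤ (ℚᵘ.- E) (ℚᵘ.≤-trans M≤M′+C (ℚᵘ.+-monoʳ-≤ M′ C≤E)) ⟩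
      (M′ ℚᵘ.+ E) ℚᵘ.- E
        ≃⟨ solve 2 (λ M′ E → (M′ :+ E) :- E := M′) ℚᵘ.≃-refl M′ E ⟩
      M′ ∎)
    where
    open ℚᵘ.≤-Reasoning
    e = P /1+ d
    M = μ /1+ 0
    M′ = μ′ /1+ 0
    C = c /1+ 0
    E = (e ℚᵘ.+ e) ℚᵘ.* M
    M≤M′+C : M ℚᵘ.≤ M′ ℚᵘ.+ C
    M≤M′+C = subst (M ℚᵘ.≤_) (sym (/1+-+ μ′ 0 c 0))
      (/1+-mono-≤ (subst₂ _≤_ (sym (*-identityʳ μ)) (shape μ′ c) μ≤μ′+c))
      where
      shape : ∀ a b → a + b ≡ (a * 1 + b * 1) * 1
      shape = solve-∀
    C≤E : C ℚᵘ.≤ E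
    C≤E = subst (C ℚᵘ.≤_)
      (sym (trans (cong (ℚᵘ._* M) (/1+-+ P d P d)) (/1+-* (P * suc d + P * suc d) (d + d * suc d) μ 0)))
      (/1+-mono-≤ (subst₂ _≤_ (shapeˡ c d) (shapeʳ P d μ) (*-monoˡ-≤ (suc d) cQ≤2Pμ)))
      where
      shapeˡ : ∀ c d → c * suc d * suc d ≡ c * suc (0 + (d + d * suc d) * 1)
      shapeˡ = solve-∀
      shapeʳ : ∀ P d μ → 2 * P * μ * suc d ≡ (P * suc d + P * suc d) * μ * 1
      shapeʳ = solve-∀

  private
    με²≃ : ∀ μ → ℚ.toℚᵘ (ℕ→ℚ μ ℚ.* (ε ℚ.* ε)) ℚᵘ.≃ (μ * (P * P)) /1+ ((d + d * suc d) + 0 * suc (d + d * suc d))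
    με²≃ μ = ℚᵘ.≃-trans (toℚᵘ-* (toℚᵘ-ℕ→ℚ μ) (toℚᵘ-* ε≃P/Q ε≃P/Q))
      (ℚᵘ.≃-reflexive (trans (cong (μ /1+ 0 ℚᵘ.*_) (/1+-* P d P d)) (/1+-* μ 0 (P * P) (d + d * suc d))))

  με²≥0 : ∀ μ → 0ℚ ℚ.≤ ℕ→ℚ μ ℚ.* (ε ℚ.* ε)
  με²≥0 μ = ≤-fromℚᵘ (toℚᵘ-ℕ→ℚ 0) (με²≃ μ) (/1+-mono-≤ z≤n)

  με²≤ : ∀ {μ t} → μ * P * P ≤ t * suc d * suc d → ℕ→ℚ μ ℚ.* (ε ℚ.* ε) ℚ.≤ ℕ→ℚ t
  με²≤ {μ} {t} μP²≤tQ² = ≤-fromℚᵘ (με²≃ μ) (toℚᵘ-ℕ→ℚ t)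
    (/1+-mono-≤ (subst₂ _≤_ (shapeˡ μ P) (shapeʳ t d) μP²≤tQ²))
    where
    shapeˡ : ∀ μ P → μ * P * P ≡ μ * (P * P) * 1
    shapeˡ = solve-∀
    shapeʳ : ∀ t d → t * suc d * suc d ≡ t * suc ((d + d * suc d) + 0 * suc (d + d * suc d))
    shapeʳ = solve-∀

-- Partial sums of the exponential series

pred2^ : ℕ → ℕ
pred2^ zero = 0
pred2^ (suc j) = suc (pred2^ j + pred2^ j)

suc-pred2^ : ∀ j → suc (pred2^ j) ≡ 2 ^ j
suc-pred2^ zero = refl
suc-pred2^ (suc j) = begin
  suc (suc (pred2^ j + pred2^ j)) ≡⟨ cong suc (+-suc (pred2^ j) (pred2^ j)) ⟨
  suc (pred2^ j) + suc (pred2^ j) ≡⟨ cong (λ z → z + z) (suc-pred2^ j) ⟩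
  2 ^ j + 2 ^ j                   ≡⟨ cong (2 ^ j +_) (+-identityʳ (2 ^ j)) ⟨
  2 ^ suc j                       ∎
  where open ≡-Reasoning

-- For 0 ≤ x ≤ T the j-th Taylor term is at most Tʲ / j! ≤ C(2T + j, j) / 2ʲ, since each
-- factor T / i is at most (2T + i) / (2i).

module ExpBound (x : ℚ) (T : ℕ) (x≥0 : 0ℚ ℚ.≤ x) (x≤T : x ℚ.≤ ℕ→ℚ T) where

  private
    N = T + T
    xᵘ = ℚ.toℚᵘ x
    xᵘ≥0 : ℚᵘ.0ℚᵘ ℚᵘ.≤ xᵘ
    xᵘ≥0 = ≤-toℚᵘ (toℚᵘ-ℕ→ℚ 0) ℚᵘ.≃-refl x≥0
    xᵘ≤T : xᵘ ℚᵘ.≤ T /1+ 0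
    xᵘ≤T = ≤-toℚᵘ ℚᵘ.≃-refl (toℚᵘ-ℕ→ℚ T) x≤T

    next-coefficient≤ : ∀ j → let c = (N + j) C j; D = pred2^ j in
      c * T * 1 * suc (suc (D + D)) ≤ ((N + suc j) C suc j) * suc (j + (0 + D * 1) * suc j)
    next-coefficient≤ j = subst₂ _≤_ (shapeˡ c T D) (shapeʳ c′ j D) (*-monoˡ-≤ (suc D) (begin
      2 * T * c       ≤⟨ *-monoˡ-≤ c (≤-trans (≤-reflexive (double T)) (≤-trans (m≤m+n N j) (n≤1+n _))) ⟩
      suc (N + j) * c ≡⟨ absorb ⟨
      suc j * c′      ∎))
      where
      open ≤-Reasoning
      c = (N + j) C j
      c′ = (N + suc j) C suc j
      D = pred2^ j
      absorb : suc j * c′ ≡ suc (N + j) * c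
      absorb rewrite +-suc N j = [1+k]*[1+n]C[1+k]≡[1+n]*nCk (N + j) j
      double : ∀ T → 2 * T ≡ T + T
      double = solve-∀
      shapeˡ : ∀ c T D → 2 * T * c * suc D ≡ c * T * 1 * suc (suc (D + D))
      shapeˡ = solve-∀
      shapeʳ : ∀ c′ j D → suc j * c′ * suc D ≡ c′ * suc (j + (0 + D * 1) * suc j)
      shapeʳ = solve-∀

  expTerm-bounds : ∀ j →
    ℚᵘ.0ℚᵘ ℚᵘ.≤ ℚ.toℚᵘ (expTerm j x) × ℚ.toℚᵘ (expTerm j x) ℚᵘ.≤ ((N + j) C j) /1+ pred2^ j
  expTerm-bounds zero =
    ℚᵘ.≤-respʳ-≃ (ℚᵘ.≃-sym (toℚᵘ-ℕ→ℚ 1)) (/1+-mono-≤ z≤n) , ℚᵘ.≤-respˡ-≃ (ℚᵘ.≃-sym (toℚᵘ-ℕ→ℚ 1)) ℚᵘ.≤-refl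
  expTerm-bounds (suc j) = ℚᵘ.≤-respʳ-≃ (ℚᵘ.≃-sym term≃) next≥0 , ℚᵘ.≤-respˡ-≃ (ℚᵘ.≃-sym term≃) next≤
    where
    E = ℚ.toℚᵘ (expTerm j x)
    E≥0 = proj₁ (expTerm-bounds j)
    c = (N + j) C j
    c′ = (N + suc j) C suc j
    D = pred2^ j
    term≃ : ℚ.toℚᵘ (expTerm (suc j) x) ℚᵘ.≃ E ℚᵘ.* xᵘ ℚᵘ.* 1 /1+ j
    term≃ = toℚᵘ-* {expTerm j x ℚ.* x} (toℚᵘ-* {expTerm j x} {x} ℚᵘ.≃-refl ℚᵘ.≃-refl) (toℚᵘ-/ 1 j)
    instance
      _ = ℚᵘ.nonNegative E≥0
      _ = ℚᵘ.nonNegative xᵘ≥0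
      _ = ℚᵘ.nonNegative (ℚᵘ.*-mono-≤-nonNeg {ℚᵘ.0ℚᵘ} {E} {ℚᵘ.0ℚᵘ} {xᵘ} E≥0 xᵘ≥0)
    next≥0 : ℚᵘ.0ℚᵘ ℚᵘ.≤ E ℚᵘ.* xᵘ ℚᵘ.* 1 /1+ j
    next≥0 = ℚᵘ.*-mono-≤-nonNeg {ℚᵘ.0ℚᵘ} {E ℚᵘ.* xᵘ} (ℚᵘ.*-mono-≤-nonNeg {ℚᵘ.0ℚᵘ} {E} E≥0 xᵘ≥0)
      (/1+-mono-≤ {0} {0} {1} {j} z≤n)
    next≤ : E ℚᵘ.* xᵘ ℚᵘ.* 1 /1+ j ℚᵘ.≤ c′ /1+ pred2^ (suc j)
    next≤ = begin
      E ℚᵘ.* xᵘ ℚᵘ.* 1 /1+ j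
        ≤⟨ ℚᵘ.*-mono-≤-nonNeg (ℚᵘ.*-mono-≤-nonNeg (proj₂ (expTerm-bounds j)) xᵘ≤T) ℚᵘ.≤-refl ⟩
      c /1+ D ℚᵘ.* T /1+ 0 ℚᵘ.* 1 /1+ j
        ≡⟨ trans (cong (ℚᵘ._* 1 /1+ j) (/1+-* c D T 0)) (/1+-* (c * T) (0 + D * 1) 1 j) ⟩
      (c * T * 1) /1+ (j + (0 + D * 1) * suc j)
        ≤⟨ /1+-mono-≤ (next-coefficient≤ j) ⟩
      c′ /1+ pred2^ (suc j) ∎
      where open ℚᵘ.≤-Reasoning

  expPartial-bound : ∀ j → ℚ.toℚᵘ (expPartial j x) ℚᵘ.≤ negBinomialSum N j /1+ pred2^ j
  expPartial-bound zero = ℚᵘ.≤-respˡ-≃ (ℚᵘ.≃-sym (toℚᵘ-ℕ→ℚ 1)) ℚᵘ.≤-refl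
  expPartial-bound (suc j) = begin
    ℚ.toℚᵘ (expPartial (suc j) x)
      ≃⟨ toℚᵘ-+ {expPartial j x} {expTerm (suc j) x} ℚᵘ.≃-refl ℚᵘ.≃-refl ⟩
    ℚ.toℚᵘ (expPartial j x) ℚᵘ.+ ℚ.toℚᵘ (expTerm (suc j) x)
      ≤⟨ ℚᵘ.+-mono-≤ (expPartial-bound j) (proj₂ (expTerm-bounds (suc j))) ⟩
    S /1+ D ℚᵘ.+ c /1+ pred2^ (suc j)
      ≡⟨ /1+-+ S D c (pred2^ (suc j)) ⟩
    (S * suc (pred2^ (suc j)) + c * suc D) /1+ (pred2^ (suc j) + D * suc (pred2^ (suc j)))
      ≤⟨ /1+-mono-≤ (≤-reflexive (shape S c D)) ⟩
    negBinomialSum N (suc j) /1+ pred2^ (suc j) ∎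
    where
    open ℚᵘ.≤-Reasoning
    S = negBinomialSum N j
    c = (N + suc j) C suc j
    D = pred2^ j
    shape : ∀ S c D → (S * suc (suc (D + D)) + c * suc D) * suc (suc (D + D))
                    ≡ (2 * S + c) * suc (suc (D + D) + D * suc (suc (D + D)))
    shape = solve-∀

expPartial≤2*4^T : ∀ {x T} j → 0ℚ ℚ.≤ x → x ℚ.≤ ℕ→ℚ T → expPartial j x ℚ.≤ ℕ→ℚ (2 * 4 ^ T)
expPartial≤2*4^T {x} {T} j x≥0 x≤T = ≤-fromℚᵘ ℚᵘ.≃-refl (toℚᵘ-ℕ→ℚ (2 * 4 ^ T))
  (ℚᵘ.≤-trans (ExpBound.expPartial-bound x T x≥0 x≤T j) (/1+-mono-≤ (begin
    negBinomialSum (T + T) j * 1 ≡⟨ *-identityʳ _ ⟩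
    negBinomialSum (T + T) j     ≤⟨ negBinomialSum≤ (T + T) j ⟩
    2 ^ (T + T) * (2 * 2 ^ j)    ≡⟨ cong₂ (λ a b → a * (2 * b)) 2^[T+T]≡4^T (sym (suc-pred2^ j)) ⟩
    4 ^ T * (2 * suc (pred2^ j)) ≡⟨ regroup (4 ^ T) (suc (pred2^ j)) ⟩
    2 * 4 ^ T * suc (pred2^ j)   ∎)))
  where
  open ≤-Reasoning
  2^[T+T]≡4^T : 2 ^ (T + T) ≡ 4 ^ T
  2^[T+T]≡4^T = trans (^-distribˡ-+-* 2 T T) (sym ([m*n]^o≡m^o*n^o 2 2 T))
  regroup : ∀ a b → a * (2 * b) ≡ 2 * a * b
  regroup = solve-∀

-- The late graph keeps a large matching

module LateMatching {n : ℕ} (2≤n : 2 ≤ n) {L : List (Edge n)} (uL : Unique L) {ε : ℚ} {P d : ℕ}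
  (ε≃P/Q : ℚ.toℚᵘ ε ℚᵘ.≃ P /1+ d) (2P<Q : 2 * P < suc d)
  (n²⁰≤exp : AtMostExp (n ^ 20) (ℕ→ℚ (μ L) ℚ.* (ε ℚ.* ε)))
  (good? : (s : List (Edge n)) → Dec ((1ℚ ℚ.- (ε ℚ.+ ε)) ℚ.* ℕ→ℚ (μ L) ℚ.≤ ℕ→ℚ (μ (late ε s))))
  where

  open FractionFacts ε≃P/Q
  open PrefixCounting (_≟ᴱ_ {n})

  m = length L
  Q = suc d
  μ₀ = μ L

  private
    M = proj₁ (maximumMatching L)
    M⊆L = proj₁ (proj₂ (maximumMatching L))
    M-matching = proj₁ (proj₂ (proj₂ (maximumMatching L)))
    ∣M∣≡μ₀ : length M ≡ μ₀
    ∣M∣≡μ₀ = proj₂ (proj₂ (proj₂ (maximumMatching L)))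

  -- r is the least integer above 2εμ, and t − 1 = ⌊r/4⌋ keeps every factor of
  -- falling-factorial-bound at most 2/3.
  k = ⌊ ε ℚ.* ℕ→ℚ m ⌋ℕ
  r = suc (2 * P * μ₀ / Q)
  t = suc (r / 4)

  kQ≤Pm : k * Q ≤ P * m
  kQ≤Pm = ⌊εm⌋*Q≤P*m m

  k≤m : k ≤ m
  k≤m = *-cancelʳ-≤ k m Q (≤-trans kQ≤Pm (≤-trans (*-monoˡ-≤ m P≤Q) (≤-reflexive (*-comm Q m))))
    where
    P≤Q : P ≤ Q
    P≤Q = ≤-trans (m≤n*m P 2) (<⇒≤ 2P<Q)

  2Pμ₀<rQ : 2 * P * μ₀ < r * Q
  2Pμ₀<rQ = m<[1+m/n]*n (2 * P * μ₀) Q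

  4[t∸1]≤r : 4 * pred t ≤ r
  4[t∸1]≤r = ≤-trans (≤-reflexive (*-comm 4 (r / 4))) (m/n*n≤m r 4)

  n²⁰≤2*4^ : ∀ {T} → μ₀ * P * P ≤ T * Q * Q → n ^ 20 ≤ 2 * 4 ^ T
  n²⁰≤2*4^ {T} μ₀P²≤TQ² = ℕ→ℚ-cancel-≤ (ℚ.≤-trans (proj₂ n²⁰≤exp)
    (expPartial≤2*4^T {T = T} (proj₁ n²⁰≤exp) (με²≥0 (μ L)) (με²≤ {μ L} {T} μ₀P²≤TQ²)))

  n²⁰≤2*4ᵗ : n ^ 20 ≤ 2 * 4 ^ t
  n²⁰≤2*4ᵗ = n²⁰≤2*4^ {t} (μP²≤tQ² {P} {Q} {μ₀} {r} {t} 2P<Q 2Pμ₀<rQ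
    (≤-trans (<⇒≤ (m<[1+m/n]*n r 4)) (≤-reflexive (*-comm t 4))))

  μ₀>0 : 0 < μ₀
  μ₀>0 = n≢0⇒n>0 λ μ₀≡0 → <⇒≱ (≤ᵇ⇒≤ 3 (2 ^ 20) _)
    (≤-trans (^-monoˡ-≤ 20 2≤n) (n²⁰≤2*4^ {0} (≤-reflexive (cong (λ z → z * P * P) μ₀≡0))))

  t≤r : t ≤ r
  t≤r = m/n<m r 4 (s≤s (s≤s z≤n))

  t≤m : t ≤ m
  t≤m = ≤-trans t≤r (≤-trans r≤μ₀ (subst (_≤ m) ∣M∣≡μ₀ (length-mono-≤ M⊆L)))
    where
    r≤μ₀ : r ≤ μ₀
    r≤μ₀ = m<n*o⇒m/o<n (≤-<-trans (≤-reflexive (*-comm (2 * P) μ₀)) (*-monoʳ-< μ₀ {{>-nonZero μ₀>0}} 2P<Q))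

  bad⇒r≤countInPrefix : ∀ {s} → s ↭ L → T (not ⌊ good? s ⌋) → r ≤ countInPrefix k M s
  bad⇒r≤countInPrefix {s} s↭L bad = ≮⇒≥ λ c<r → T-not⌊⌋⇒¬ (good? s) bad (good-if c<r)
    where
    c = countInPrefix k M s
    late≡drop : late ε s ≡ drop k s
    late≡drop = cong (λ z → drop ⌊ ε ℚ.* ℕ→ℚ z ⌋ℕ s) (↭-length s↭L)
    μ₀≤μ[late]+c : μ₀ ≤ μ (late ε s) + c
    μ₀≤μ[late]+c = subst₂ _≤_ ∣M∣≡μ₀ (trans (+-comm c _) (cong (λ z → μ z + c) (sym late≡drop)))
      (length≤countInPrefix+μ[drop] uL M⊆L M-matching s↭L k)
    good-if : c < r → (1ℚ ℚ.- (ε ℚ.+ ε)) ℚ.* ℕ→ℚ (μ L) ℚ.≤ ℕ→ℚ (μ (late ε s))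
    good-if c<r = [1-2ε]μ≤ {μ L} {μ (late ε s)} {c} μ₀≤μ[late]+c
      (≤-trans (*-monoˡ-≤ Q (≤-pred c<r)) (m/n*n≤m (2 * P * μ₀) Q))

  #bad : ℕ
  #bad = count (λ s → not ⌊ good? s ⌋) (permutations L)

  #bad*rCt≤ : #bad * (r C t) ≤ (μ₀ C t) * ((k P′ t) * (m ∸ t) !)
  #bad*rCt≤ = begin
    #bad * (r C t)
      ≤⟨ count*≤∑ (permutations-↭ L) (λ s↭L bad → C-monoˡ-≤ t (bad⇒r≤countInPrefix s↭L bad)) ⟩
    ∑ (λ s → countInPrefix k M s C t) (permutations L)
      ≤⟨ ∑-C-countInPrefix≤ uL M⊆L k t k≤m ⟩
    (length M C t) * ((k P′ t) * (m ∸ t) !)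
      ≡⟨ cong (λ z → (z C t) * ((k P′ t) * (m ∸ t) !)) ∣M∣≡μ₀ ⟩
    (μ₀ C t) * ((k P′ t) * (m ∸ t) !) ∎
    where open ≤-Reasoning

  n⁵*#bad≤#permutations : n ^ 5 * #bad ≤ length (permutations L)
  n⁵*#bad≤#permutations = *-cancelˡ-≤ (r P′ t) {{>-nonZero (nP′k>0 t≤r)}} (begin
    (r P′ t) * (n ^ 5 * #bad)                 ≡⟨ cong (λ z → z * (n ^ 5 * #bad)) (nCk*k!≡nP′k r t) ⟨
    (r C t) * t ! * (n ^ 5 * #bad)            ≡⟨ regroup (r C t) (t !) (n ^ 5) #bad ⟩
    n ^ 5 * (#bad * (r C t) * t !)            ≤⟨ *-monoʳ-≤ (n ^ 5) (*-monoˡ-≤ (t !) #bad*rCt≤) ⟩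
    n ^ 5 * ((μ₀ C t) * ((k P′ t) * F) * t !) ≡⟨ regroup′ (n ^ 5) (μ₀ C t) (k P′ t) F (t !) ⟩
    n ^ 5 * ((μ₀ C t) * t ! * (k P′ t)) * F   ≡⟨ cong (λ z → n ^ 5 * (z * (k P′ t)) * F) (nCk*k!≡nP′k μ₀ t) ⟩
    n ^ 5 * ((μ₀ P′ t) * (k P′ t)) * F        ≤⟨ *-monoˡ-≤ F falling-factorials ⟩
    (r P′ t) * (m P′ t) * F                   ≡⟨ *-assoc (r P′ t) (m P′ t) F ⟩
    (r P′ t) * ((m P′ t) * F)                 ≡⟨ cong ((r P′ t) *_) (nP′k*[n∸k]!≡n! t≤m) ⟩
    (r P′ t) * m !                            ≡⟨ cong ((r P′ t) *_) (length-permutations L) ⟨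
    (r P′ t) * length (permutations L)        ∎)
    where
    open ≤-Reasoning
    F = (m ∸ t) !
    falling-factorials : n ^ 5 * ((μ₀ P′ t) * (k P′ t)) ≤ (r P′ t) * (m P′ t)
    falling-factorials = falling-factorial-bound {n} {P} {Q} {μ₀} {k} {m} {r} {t}
      2≤n (s≤s z≤n) kQ≤Pm k≤m 2Pμ₀<rQ 4[t∸1]≤r n²⁰≤2*4ᵗ
    regroup : ∀ a b c d → a * b * (c * d) ≡ c * (d * a * b)
    regroup = solve-∀
    regroup′ : ∀ a b c d e → a * (b * (c * d) * e) ≡ a * (b * e * c) * d
    regroup′ = solve-∀

  late-matching-bound : (n ^ 5 ∸ 1) * length (permutations L) ≤ n ^ 5 * count (λ s → ⌊ good? s ⌋) (permutations L)
  late-matching-bound = complement-bound {n ^ 5} {count (λ s → ⌊ good? s ⌋) (permutations L)} {#bad}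
    (count+count-not≡length (λ s → ⌊ good? s ⌋) (permutations L)) n⁵*#bad≤#permutations

mainTheorem2 : (n : ℕ) → .{{_ : NonZero n}} → (G : SimpleGraph n) → (ε : ℚ) →
    0ℚ ℚ.< ε → ε ℚ.< ½ →
    -- μ(G) ≥ 20 ln(n) ε⁻²  ⇔  n^20 ≤ exp(μ(G) ε²)
    AtMostExp (n ^ 20) (ℕ→ℚ (μ (SimpleGraph.edges G)) ℚ.* (ε ℚ.* ε)) →
    -- Pr_σ[ μ(G^late) ≥ (1 − 2ε) μ(G) ] ≥ 1 − n⁻⁵, cross-multiplied by n⁵ · (#orderings)
    (n ^ 5 ∸ 1) ℕ.* length (permutations (SimpleGraph.edges G))
      ℕ.≤ n ^ 5 ℕ.* count
            (λ s → ⌊ (1ℚ ℚ.- (ε ℚ.+ ε)) ℚ.* ℕ→ℚ (μ (SimpleGraph.edges G))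
                       ℚ.≤? ℕ→ℚ (μ (late ε s)) ⌋)
            (permutations (SimpleGraph.edges G))
mainTheorem2 zero _ _ _ _ _ = z≤n
mainTheorem2 (suc zero) _ _ _ _ _ = z≤n
mainTheorem2 (suc (suc _)) G ε ε>0 ε<½ n²⁰≤exp =
  let P , d , ε≃P/Q , 2P<Q = fraction-below-half ε>0 ε<½
  in LateMatching.late-matching-bound (s≤s (s≤s z≤n)) (SimpleGraph.distinct G) ε≃P/Q 2P<Q n²⁰≤exp
       (λ _ → _ ℚ.≤? _)
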